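{- Let $G$ be a finite simple graph with at least two vertices, and let $\pi(G)\in\mathcal{G}$ be its projection to the subspace of primitive elements of the Hopf algebra of graphs along the subspace of decomposable elements. Then $Q_{\pi(G)}(u)$ is a constant polynomial (an element of $\mathbb{C}$).
   Context: For a finite simple graph $G$, $A_G$ is its adjacency matrix over $\mathbb{F}_2$; the nondegeneracy $\nu(G)\in\{0,1\}\subset\mathbb{C}$ is $1$ iff $A_G$ is invertible over $\mathbb{F}_2$, with $\nu(\text{empty graph})=1$. For $U\subseteq V(G)$, $G(U)$ is the induced subgraph. The skew characteristic polynomial is $Q_G(u)=\sum_{k\ge0}q_k(G)u^{|V(G)|-k}$ with $q_k(G)=\sum_{U\subseteq V(G),|U|=k}\nu(G(U))$. Let $\mathcal{G}$ be the $\mathbb{C}$-vector space with basis the isomorphism classes of finite simple graphs; it is a graded commutative cocommutative Hopf algebra (grading by number of vertices) with product the disjoint union (unit the empty graph) and coproduct $\mu(G)=\sum_{V_1\subseteq V(G)}G(V_1)\otimes G(V(G)\setminus V_1)$. Decomposable elements of degree $n$ are linear combinations of products of elements of lower positive degree; primitive elements $p$ satisfy $\mu(p)=1\otimes p+p\otimes 1$, and $\mathcal{G}_n$ is the direct sum of primitives and decomposables for $n\ge1$. The projection $\pi$ onto primitives along decomposables is given explicitly by $\pi(G)=\sum_{k\ge1}(-1)^{k-1}(k-1)!\sum_{\{I_1,\dots,I_k\}}G(I_1)G(I_2)\cdots G(I_k)$, where the inner sum runs over all partitions of $V(G)$ into $k$ unordered nonempty blocks. $Q$ is extended to $\mathcal{G}$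 by linearity. -}

module Defs where

open import Data.Nat as ℕ using (ℕ; zero; suc; _≤?_; _∸_)
open import Data.Nat.Base using (_!)
open import Relation.Nullary using (yes; no)
open import Data.Integer as ℤ using (ℤ; +_; -_; _*_; _+_; _^_)
open import Data.Bool using (Bool; true; false; _∧_; _xor_; if_then_else_)
open import Data.Fin as Fin using (Fin; splitAt; punchIn; _≟_)
open import Data.Fin.Subset using (Subset; ∣_∣)
open import Data.Vec as Vec using (Vec; []; _∷_; _∷ʳ_; lookup)
open import Data.List as List using (List; []; _∷_; concatMap; foldr; filter; map; allFin)
open import Data.Product using (_×_; _,_; Σ; proj₁; proj₂)
open import Data.Sum using (inj₁; inj₂)
open import Relation.Nullary.Decidable using (⌊_⌋)
open import Relation.Binary.PropositionalEquality using (_≡_)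

record Graph : Set where
  constructor mkGraph
  field
    n   : ℕ
    adj : Fin n → Fin n → Bool
open Graph public

IsSimple : Graph → Set
IsSimple G = (∀ i j → adj G i j ≡ adj G j i) × (∀ i → adj G i i ≡ false)

-- Determinant over F₂ (Bool with xor/∧), Laplace expansion along the first row
-- (signs vanish in characteristic 2).
det₂ : ∀ n → (Fin n → Fin n → Bool) → Bool
det₂ zero    M = true
det₂ (suc n) M =
  foldr _xor_ false
    (map (λ j → M Fin.zero j ∧ det₂ n (λ r c → M (Fin.suc r) (punchIn j c))) (allFin (suc n)))

-- Nondegeneracy ν(G) ∈ {0,1}: 1 iff A_G invertible over F₂ (det ≠ 0); ν(empty) = 1.
ν : Graph → ℤ
ν G = if det₂ (n G) (adj G) then + 1 else + 0

induce : (G : Graph) → List (Fin (n G)) → Graph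
induce G vs = mkGraph (List.length vs) (λ i j → adj G (lookup v i) (lookup v j))
  where v = Vec.fromList vs

allSubsets : ∀ n → List (Subset n)
allSubsets zero    = [] ∷ []
allSubsets (suc n) = concatMap (λ s → (true ∷ s) ∷ (false ∷ s) ∷ []) (allSubsets n)

elems : ∀ {n} → Subset n → List (Fin n)
elems {n} U = filter (λ i → lookup U i Data.Bool.≟ true) (allFin n)
  where import Data.Bool

sumℤ : List ℤ → ℤ
sumℤ = foldr _+_ (+ 0)

q : ℕ → Graph → ℤ
q k G = sumℤ (map (λ U → if ⌊ ∣ U ∣ ℕ.≟ k ⌋ then ν (induce G (elems U)) else + 0)
                  (allSubsets (n G)))

-- Coefficient of u^m in Q_G(u) = Σ_k q_k(G) u^{|V(G)| - k}.
coeffQ : Graph → ℕ → ℤ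
coeffQ G m with m ≤? n G
... | yes _ = q (n G ∸ m) G
... | no  _ = + 0

-- Elements of 𝒢: formal ℤ-linear combinations of graphs (coefficients of π(G)
-- are integers).  Q extended linearly.
Elem : Set
Elem = List (ℤ × Graph)

coeffQElem : Elem → ℕ → ℤ
coeffQElem x m = sumℤ (map (λ cg → proj₁ cg * coeffQ (proj₂ cg) m) x)

-- Product in 𝒢 on graphs: disjoint union; unit: the empty graph.
emptyGraph : Graph
emptyGraph = mkGraph 0 (λ ())

_⊔_ : Graph → Graph → Graph
G ⊔ H = mkGraph (n G ℕ.+ n H) a
  where
  a : Fin (n G ℕ.+ n H) → Fin (n G ℕ.+ n H) → Bool
  a i j with splitAt (n G) i | splitAt (n G) j
  ... | inj₁ i' | inj₁ j' = adj G i' j'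
  ... | inj₂ i' | inj₂ j' = adj H i' j'
  ... | _       | _       = false

-- Set partitions of Fin n, encoded as restricted growth strings:
-- (k , v) with v : Vec (Fin k) n, blocks numbered in order of first occurrence.
-- This is a bijection with the unordered partitions of Fin n into k nonempty blocks.
partitions : ∀ n → List (Σ ℕ (λ k → Vec (Fin k) n))
partitions zero    = (0 , []) ∷ []
partitions (suc n) = concatMap ext (partitions n)
  where
  ext : Σ ℕ (λ k → Vec (Fin k) n) → List (Σ ℕ (λ k → Vec (Fin k) (suc n)))
  ext (k , v) =
    (suc k , (Vec.map Fin.inject₁ v ∷ʳ Fin.fromℕ k))
    ∷ map (λ j → (k , (v ∷ʳ j))) (allFin k)

block : ∀ {n k} → Vec (Fin k) n → Fin k → List (Fin n)
block {n} v j = filter (λ i → lookup v i ≟ j) (allFin n)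

blockProduct : (G : Graph) → ∀ {k} → Vec (Fin k) (n G) → Graph
blockProduct G {k} v = foldr (λ j H → induce G (block v j) ⊔ H) emptyGraph (allFin k)

-- (-1)^{k-1} (k-1)! for k ≥ 1 (k = 0 never contributes).
piCoeff : ℕ → ℤ
piCoeff zero    = + 0
piCoeff (suc k) = ((- (+ 1)) ^ k) * (+ (k !))

π : Graph → Elem
π G = map (λ kv → piCoeff (proj₁ kv) , blockProduct G (proj₂ kv)) (partitions (n G))

IsConstantQ : Elem → Set
IsConstantQ x = ∀ m → 1 ℕ.≤ m → coeffQElem x m ≡ + 0

-- Expanding π(G) over the set partitions P = {I₁, …, I_k} of V(G), with weight
-- μ(P) = (-1)^(k-1) (k-1)!, and using that ν is multiplicative on disjoint unions
-- (the F₂-determinant of a block-diagonal matrix), the coefficient of u^(N-s) in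
-- Q_π(G) becomes Σ_{|U| = s} Σ_P μ(P) ∏_j ν(G(U ∩ I_j)), where N = |V(G)|.
-- For s < N the set U misses some vertex i, so f(B) = ν(G(U ∩ B)) does not see i.
-- For every such f with f(∅) = 1 the partition sum Σ_P μ(P) ∏_{B ∈ P} f(B) is 1
-- if N = 1 and 0 otherwise. This is proved by induction on N, peeling off the last
-- vertex: extending the partitions of N by the last vertex turns the partition sum
-- into the ε-coefficient of a partition sum over N of a function with values in the
-- dual numbers R[ε]/(ε²), so the ring changes at every step of the induction.

module Submission where

open import Defs
open import Data.Nat using (_≤_)

open import Level using (0ℓ)
open import Algebra.Bundles using (CommutativeRing; Ring; Semiring)
open import Algebra.Structures using (IsCommutativeRing)
open import Data.Bool using (Bool; true; false; if_then_else_)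
open import Data.Fin as Fin using (Fin; zero; suc; inject₁; fromℕ)
open import Data.Fin.Properties using (_≟_)
open import Data.Fin.Relation.Unary.Top using (view; ‵fromℕ; ‵inject₁)
open import Data.Fin.Subset using (∣_∣)
open import Data.Integer as ℤ using (ℤ)
import Data.Integer.Properties as ℤ
open import Data.List as List using (List; []; _∷_; _++_; map; foldr; concatMap; allFin; tabulate)
import Data.List.Properties as List
open import Data.Nat as ℕ using (ℕ; zero; suc; _!; _∸_; _≤?_)
open import Data.Nat.Properties using (∸-monoʳ-<)
open import Data.Product using (Σ; _×_; _,_; proj₁; proj₂)
open import Function using (_∘_; id)
open import Relation.Binary.PropositionalEquality
open import Relation.Nullary using (does; yes; no)

-- A commutative ring together with its ring map from ℤ, through which the integer
-- weights piCoeff act in every ring of iterated dual numbers.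
record ℤAlgebra : Set₁ where
  infix  8 -_
  infixl 7 _*_
  infixl 6 _+_
  field
    Carrier           : Set
    _+_ _*_           : Carrier → Carrier → Carrier
    -_                : Carrier → Carrier
    0# 1#             : Carrier
    isCommutativeRing : IsCommutativeRing _≡_ _+_ _*_ -_ 0# 1#
    ι                 : ℤ → Carrier
    ι-+               : ∀ a b → ι (a ℤ.+ b) ≡ ι a + ι b
    ι-*               : ∀ a b → ι (a ℤ.* b) ≡ ι a * ι b
    ι-1               : ι (ℤ.+ 1) ≡ 1#

  commutativeRing : CommutativeRing 0ℓ 0ℓ
  commutativeRing = record { isCommutativeRing = isCommutativeRing }

  open IsCommutativeRing isCommutativeRing public
    using ( +-assoc; +-comm; +-identityˡ; +-identityʳ; -‿inverseˡ; -‿inverseʳ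
          ; *-assoc; *-comm; *-identityˡ; *-identityʳ; distribˡ; distribʳ; zeroˡ; zeroʳ)

ℤ-algebra : ℤAlgebra
ℤ-algebra = record
  { isCommutativeRing = ℤ.+-*-isCommutativeRing
  ; ι = id ; ι-+ = λ _ _ → refl ; ι-* = λ _ _ → refl ; ι-1 = refl }

module ℤAlgebraProperties (R : ℤAlgebra) where

  open ℤAlgebra R public
  open CommutativeRing commutativeRing using (ring; semiring; commutativeSemiring; +-group; +-abelianGroup; +-commutativeSemigroup; *-monoid)
  open Ring ring using (ringWithoutOne)
  open Semiring semiring using (rawSemiring)

  open import Algebra.Solver.Ring.NaturalCoefficients.Default commutativeSemiring public
    using (solve; _:+_; _:*_; _:=_; con)
  open import Algebra.Definitions.RawSemiring rawSemiring public
    using (product; _^_)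
  open import Algebra.Properties.Semiring.Sum semiring public
    using (sum; sum-cong-≗; *-distribˡ-sum)
  open import Algebra.Properties.Monoid.Sum *-monoid public
    using () renaming (sum-cong-≗ to product-cong-≗; sum-init-last to product-init-last)
  open import Algebra.Properties.RingWithoutOne ringWithoutOne public
    using (-‿distribˡ-*)
  open import Algebra.Properties.AbelianGroup +-abelianGroup public using (⁻¹-∙-comm)
  open import Algebra.Properties.Group +-group public using (inverseʳ-unique; identityˡ-unique)
  open import Algebra.Properties.CommutativeSemigroup +-commutativeSemigroup public using () renaming (interchange to +-interchange)

  ι-0 : ι (ℤ.+ 0) ≡ 0#
  ι-0 = identityˡ-unique (ι (ℤ.+ 0)) (ι (ℤ.+ 0)) (sym (ι-+ (ℤ.+ 0) (ℤ.+ 0)))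

  ι-neg : ∀ z → ι (ℤ.- z) ≡ - ι z
  ι-neg z = inverseʳ-unique (ι z) (ι (ℤ.- z)) (trans (sym (ι-+ z (ℤ.- z))) (trans (cong ι (ℤ.+-inverseʳ z)) ι-0))

  ι-suc : ∀ k → ι (ℤ.+ suc k) ≡ 1# + ι (ℤ.+ k)
  ι-suc k = trans (ι-+ (ℤ.+ 1) (ℤ.+ k)) (cong (_+ ι (ℤ.+ k)) ι-1)

  product-scale : ∀ k u (h : Fin k → Carrier) → product (λ j → u * h j) ≡ u ^ k * product h
  product-scale zero    u h = sym (*-identityˡ _)
  product-scale (suc k) u h = trans (cong (u * h zero *_) (product-scale k u (h ∘ suc)))
    (solve 4 (λ u a p q → ((u :* a) :* (p :* q)) := ((u :* p) :* (a :* q))) refl u (h zero) (u ^ k) (product (h ∘ suc)))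

  sumOver : {A : Set} → List A → (A → Carrier) → Carrier
  sumOver xs f = foldr _+_ 0# (map f xs)

  private variable
    A B : Set

  sumOver-cong : ∀ (xs : List A) {f g : A → Carrier} → (∀ x → f x ≡ g x) → sumOver xs f ≡ sumOver xs g
  sumOver-cong []       e = refl
  sumOver-cong (x ∷ xs) e = cong₂ _+_ (e x) (sumOver-cong xs e)

  sumOver-zero : ∀ (xs : List A) {f : A → Carrier} → (∀ x → f x ≡ 0#) → sumOver xs f ≡ 0#
  sumOver-zero []       e = refl
  sumOver-zero (x ∷ xs) e = trans (cong₂ _+_ (e x) (sumOver-zero xs e)) (+-identityˡ 0#)

  sumOver-++ : ∀ (xs ys : List A) f → sumOver (xs ++ ys) f ≡ sumOver xs f + sumOver ys f
  sumOver-++ []       ys f = sym (+-identityˡ _)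
  sumOver-++ (x ∷ xs) ys f = trans (cong (f x +_) (sumOver-++ xs ys f)) (sym (+-assoc _ _ _))

  sumOver-+ : ∀ (xs : List A) f g → sumOver xs (λ x → f x + g x) ≡ sumOver xs f + sumOver xs g
  sumOver-+ []       f g = sym (+-identityˡ 0#)
  sumOver-+ (x ∷ xs) f g = trans (cong (f x + g x +_) (sumOver-+ xs f g)) (+-interchange (f x) (g x) _ _)

  *-distribˡ-sumOver : ∀ w (xs : List A) f → w * sumOver xs f ≡ sumOver xs (λ x → w * f x)
  *-distribˡ-sumOver w []       f = zeroʳ w
  *-distribˡ-sumOver w (x ∷ xs) f = trans (distribˡ w (f x) _) (cong (w * f x +_) (*-distribˡ-sumOver w xs f))

  sumOver-concatMap : ∀ (g : A → List B) xs F →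
    sumOver (concatMap g xs) F ≡ sumOver xs (λ x → sumOver (g x) F)
  sumOver-concatMap g []       F = refl
  sumOver-concatMap g (x ∷ xs) F =
    trans (sumOver-++ (g x) (concatMap g xs) F) (cong (sumOver (g x) F +_) (sumOver-concatMap g xs F))

  sumOver-map : ∀ (g : A → B) xs F → sumOver (map g xs) F ≡ sumOver xs (F ∘ g)
  sumOver-map g xs F = cong (foldr _+_ 0#) (sym (List.map-∘ xs))

  sumOver-pairs : ∀ (g h : A → B) xs F →
    sumOver (concatMap (λ x → g x ∷ h x ∷ []) xs) F ≡ sumOver xs (λ x → F (g x) + F (h x))
  sumOver-pairs g h xs F = trans (sumOver-concatMap _ xs F)
    (sumOver-cong xs (λ x → cong (F (g x) +_) (+-identityʳ (F (h x)))))

  sumOver-swap : ∀ (xs : List A) (ys : List B) (F : A → B → Carrier) →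
    sumOver xs (λ x → sumOver ys (F x)) ≡ sumOver ys (λ y → sumOver xs (λ x → F x y))
  sumOver-swap []       ys F = sym (sumOver-zero ys (λ _ → refl))
  sumOver-swap (x ∷ xs) ys F =
    trans (cong (sumOver ys (F x) +_) (sumOver-swap xs ys F)) (sym (sumOver-+ ys (F x) _))

  sumOver-allFin : ∀ k (h : Fin k → Carrier) → sumOver (allFin k) h ≡ sum h
  sumOver-allFin k h = trans (cong (foldr _+_ 0#) (List.map-tabulate id h)) (foldr-tabulate k)
    where
    foldr-tabulate : ∀ k {h : Fin k → Carrier} → foldr _+_ 0# (tabulate h) ≡ sum h
    foldr-tabulate zero    = refl
    foldr-tabulate (suc k) = cong (_ +_) (foldr-tabulate k)

module DualNumbers (R : ℤAlgebra) where

  open ℤAlgebraProperties R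

  infixl 7 _⊠_
  infixl 6 _⊞_

  _⊞_ _⊠_ : Carrier × Carrier → Carrier × Carrier → Carrier × Carrier
  (a , b) ⊞ (c , d) = a + c , b + d
  (a , b) ⊠ (c , d) = a * c , a * d + b * c

  ⊟_ : Carrier × Carrier → Carrier × Carrier
  ⊟ (a , b) = - a , - b

  private
    pair-≡ : ∀ {a b c d : Carrier} → a ≡ c → b ≡ d → (a , b) ≡ (c , d)
    pair-≡ = cong₂ _,_

    0+0 : 0# + 0# ≡ 0#
    0+0 = +-identityˡ 0#

  isCommutativeRing-dual : IsCommutativeRing _≡_ _⊞_ _⊠_ ⊟_ (0# , 0#) (1# , 0#)
  isCommutativeRing-dual = record
    { isRing = record
      { +-isAbelianGroup = record
        { isGroup = record
          { isMonoid = record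
            { isSemigroup = record
              { isMagma = record { isEquivalence = isEquivalence ; ∙-cong = cong₂ _⊞_ }
              ; assoc = λ { (a , b) (c , d) (e , f) → pair-≡ (+-assoc a c e) (+-assoc b d f) } }
            ; identity = (λ { (a , b) → pair-≡ (+-identityˡ a) (+-identityˡ b) })
                       , (λ { (a , b) → pair-≡ (+-identityʳ a) (+-identityʳ b) }) }
          ; inverse = (λ { (a , b) → pair-≡ (-‿inverseˡ a) (-‿inverseˡ b) })
                    , (λ { (a , b) → pair-≡ (-‿inverseʳ a) (-‿inverseʳ b) })
          ; ⁻¹-cong = cong ⊟_ }
        ; comm = λ { (a , b) (c , d) → pair-≡ (+-comm a c) (+-comm b d) } }
      ; *-cong = cong₂ _⊠_
      ; *-assoc = λ { (a , b) (c , d) (e , f) → pair-≡ (*-assoc a c e)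
          (solve 6 (λ a b c d e f → ((a :* c) :* f :+ (a :* d :+ b :* c) :* e) := (a :* (c :* f :+ d :* e) :+ b :* (c :* e))) refl a b c d e f) }
      ; *-identity = (λ { (a , b) → pair-≡ (*-identityˡ a) (solve 2 (λ a b → (con 1 :* b :+ con 0 :* a) := b) refl a b) })
                   , (λ { (a , b) → pair-≡ (*-identityʳ a) (solve 2 (λ a b → (a :* con 0 :+ b :* con 1) := b) refl a b) })
      ; distrib = (λ { (a , b) (c , d) (e , f) → pair-≡ (distribˡ a c e)
                     (solve 6 (λ a b c d e f → (a :* (d :+ f) :+ b :* (c :+ e)) := ((a :* d :+ b :* c) :+ (a :* f :+ b :* e))) refl a b c d e f) })
                , (λ { (a , b) (c , d) (e , f) → pair-≡ (distribʳ a c e)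
                     (solve 6 (λ a b c d e f → ((c :+ e) :* b :+ (d :+ f) :* a) := ((c :* b :+ d :* a) :+ (e :* b :+ f :* a))) refl a b c d e f) })
      }
    ; *-comm = λ { (a , b) (c , d) → pair-≡ (*-comm a c) (solve 4 (λ a b c d → (a :* d :+ b :* c) := (c :* b :+ d :* a)) refl a b c d) }
    }

  dual : ℤAlgebra
  dual = record
    { isCommutativeRing = isCommutativeRing-dual
    ; ι   = λ z → ι z , 0#
    ; ι-+ = λ a b → pair-≡ (ι-+ a b) (sym 0+0)
    ; ι-* = λ a b → pair-≡ (ι-* a b) (sym (trans (cong₂ _+_ (zeroʳ _) (zeroˡ _)) 0+0))
    ; ι-1 = pair-≡ ι-1 refl
    }

  module D = ℤAlgebraProperties dual

  ε-part : Carrier × Carrier → Carrier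
  ε-part = proj₂

  proj₁-product : ∀ k (h : Fin k → Carrier × Carrier) → proj₁ (D.product h) ≡ product (proj₁ ∘ h)
  proj₁-product zero    h = refl
  proj₁-product (suc k) h = cong (proj₁ (h zero) *_) (proj₁-product k (h ∘ suc))

  ε-part-product : ∀ k (a b : Fin k → Carrier) →
    ε-part (D.product (λ j → a j , b j)) ≡ sum (λ i → product (λ j → if does (i ≟ j) then b j else a j))
  ε-part-product zero    a b = refl
  ε-part-product (suc k) a b = trans
    (cong₂ _+_ (trans (cong (a zero *_) (ε-part-product k (a ∘ suc) (b ∘ suc))) (*-distribˡ-sum (a zero) tail-terms))
               (cong (b zero *_) (proj₁-product k (λ j → a (suc j) , b (suc j)))))
    (+-comm _ _)
    where
    tail-terms = λ i → product (λ j → if does (i ≟ j) then b (suc j) else a (suc j))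

  ε-part-product-zero : ∀ k (h : Fin k → Carrier × Carrier) → (∀ j → ε-part (h j) ≡ 0#) → ε-part (D.product h) ≡ 0#
  ε-part-product-zero zero    h e = refl
  ε-part-product-zero (suc k) h e = trans
    (cong₂ _+_ (trans (cong (proj₁ (h zero) *_) (ε-part-product-zero k (h ∘ suc) (e ∘ suc))) (zeroʳ _))
               (trans (cong (_* proj₁ (D.product (h ∘ suc))) (e zero)) (zeroˡ _)))
    0+0

  ε-part-ι-* : ∀ z X → ε-part (D.ι z D.* X) ≡ ι z * ε-part X
  ε-part-ι-* z X = trans (cong (ι z * ε-part X +_) (zeroˡ _)) (+-identityʳ _)

  ε-part-sumOver : ∀ {A : Set} (xs : List A) f → ε-part (D.sumOver xs f) ≡ sumOver xs (ε-part ∘ f)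
  ε-part-sumOver []       f = refl
  ε-part-sumOver (x ∷ xs) f = cong (ε-part (f x) +_) (ε-part-sumOver xs f)

  1-cε^ : ∀ c k → (1# , - c) D.^ k ≡ (1# , - (ι (ℤ.+ k) * c))
  1-cε^ c zero    = pair-≡ refl (sym (trans (cong -_ (trans (cong (_* c) ι-0) (zeroˡ c))) -0#≡0#))
    where
    -0#≡0# : - 0# ≡ 0#
    -0#≡0# = trans (sym (+-identityˡ (- 0#))) (-‿inverseʳ 0#)
  1-cε^ c (suc k) = trans (cong ((1# , - c) D.*_) (1-cε^ c k)) (pair-≡ (*-identityˡ 1#) ε-coefficient)
    where
    open ≡-Reasoning
    ε-coefficient : 1# * - (ι (ℤ.+ k) * c) + - c * 1# ≡ - (ι (ℤ.+ suc k) * c)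
    ε-coefficient = begin
      1# * - (ι (ℤ.+ k) * c) + - c * 1#   ≡⟨ cong₂ _+_ (*-identityˡ _) (*-identityʳ _) ⟩
      - (ι (ℤ.+ k) * c) + - c             ≡⟨ +-comm _ _ ⟩
      - c + - (ι (ℤ.+ k) * c)             ≡⟨ ⁻¹-∙-comm c (ι (ℤ.+ k) * c) ⟩
      - (c + ι (ℤ.+ k) * c)               ≡⟨ cong -_ (cong (_+ ι (ℤ.+ k) * c) (sym (*-identityˡ c))) ⟩
      - (1# * c + ι (ℤ.+ k) * c)          ≡⟨ cong -_ (sym (distribʳ c 1# (ι (ℤ.+ k)))) ⟩
      - ((1# + ι (ℤ.+ k)) * c)            ≡⟨ cong (λ z → - (z * c)) (sym (ι-suc k)) ⟩
      - (ι (ℤ.+ suc k) * c)               ∎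

  ε-part-product-1-ε : ∀ k c (a b : Fin k → Carrier) →
    ε-part (D.product (λ j → (1# , - c) D.* (a j , b j)))
      ≡ sum (λ i → product (λ j → if does (i ≟ j) then b j else a j)) + - (ι (ℤ.+ k) * c) * product a
  ε-part-product-1-ε k c a b = begin
    ε-part (D.product (λ j → (1# , - c) D.* h j))           ≡⟨ cong ε-part (D.product-scale k (1# , - c) h) ⟩
    ε-part ((1# , - c) D.^ k D.* D.product h)                ≡⟨ cong (λ z → ε-part (z D.* D.product h)) (1-cε^ c k) ⟩
    1# * ε-part (D.product h) + - (ι (ℤ.+ k) * c) * proj₁ (D.product h)
      ≡⟨ cong₂ (λ x y → x + - (ι (ℤ.+ k) * c) * y) (trans (*-identityˡ _) (ε-part-product k a b)) (proj₁-product k h) ⟩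
    sum (λ i → product (λ j → if does (i ≟ j) then b j else a j)) + - (ι (ℤ.+ k) * c) * product a ∎
    where
    open ≡-Reasoning
    h = λ j → a j , b j

module Blocks where

  open import Data.Vec as Vec using (Vec; _∷ʳ_; lookup)
  open import Data.Fin.Properties using (inject₁-injective; fromℕ≢inject₁)
  open import Data.List using (filter)
  import Data.List.Relation.Unary.All as All
  open import Relation.Nullary using (Dec; ¬?)
  open import Relation.Nullary.Decidable using (dec-false)
  open import Relation.Unary using (Pred; Decidable)

  private variable
    A B : Set

  filter-map : ∀ {P : Pred B 0ℓ} (P? : Decidable P) (f : A → B) xs →
               filter P? (map f xs) ≡ map f (filter (P? ∘ f) xs)
  filter-map P? f []       = refl
  filter-map P? f (x ∷ xs) with does (P? (f x))
  ... | true  = cong (f x ∷_) (filter-map P? f xs)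
  ... | false = filter-map P? f xs

  cons-if : Bool → A → List A → List A
  cons-if t x L = if t then x ∷ L else L

  filter-∷ : ∀ {P : Pred A 0ℓ} (P? : Decidable P) x xs → filter P? (x ∷ xs) ≡ cons-if (does (P? x)) x (filter P? xs)
  filter-∷ P? x xs with does (P? x)
  ... | true  = refl
  ... | false = refl

  allFin-suc : ∀ n → allFin (suc n) ≡ map inject₁ (allFin n) ++ fromℕ n ∷ []
  allFin-suc n = trans (tabulate-suc n id) (cong (_++ fromℕ n ∷ []) (sym (List.map-tabulate id inject₁)))
    where
    tabulate-suc : ∀ n (f : Fin (suc n) → A) → tabulate f ≡ tabulate (f ∘ inject₁) ++ f (fromℕ n) ∷ []
    tabulate-suc zero    f = refl
    tabulate-suc (suc n) f = cong (f zero ∷_) (tabulate-suc n (f ∘ suc))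

  allFin-suc-map : ∀ n → allFin (suc n) ≡ zero ∷ map suc (allFin n)
  allFin-suc-map n = cong (zero ∷_) (sym (List.map-tabulate id suc))

  lookup-∷ʳ-inject₁ : ∀ {n} (v : Vec A n) a i → lookup (v ∷ʳ a) (inject₁ i) ≡ lookup v i
  lookup-∷ʳ-inject₁ (x Vec.∷ v) a zero    = refl
  lookup-∷ʳ-inject₁ (x Vec.∷ v) a (suc i) = lookup-∷ʳ-inject₁ v a i

  lookup-∷ʳ-fromℕ : ∀ {n} (v : Vec A n) a → lookup (v ∷ʳ a) (fromℕ n) ≡ a
  lookup-∷ʳ-fromℕ Vec.[]       a = refl
  lookup-∷ʳ-fromℕ (x Vec.∷ v) a = lookup-∷ʳ-fromℕ v a

  fromℕ≟inject₁ : ∀ {n} (i : Fin n) → does (fromℕ n ≟ inject₁ i) ≡ false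
  fromℕ≟inject₁ i = dec-false (_ ≟ inject₁ i) fromℕ≢inject₁

  block-∷ʳ : ∀ {k n} (v : Vec (Fin k) n) a j →
    block (v ∷ʳ a) j ≡ map inject₁ (block v j) ++ cons-if (does (a ≟ j)) (fromℕ n) []
  block-∷ʳ {k} {n} v a j = begin
    filter P? (allFin (suc n))
      ≡⟨ cong (filter P?) (allFin-suc n) ⟩
    filter P? (map inject₁ (allFin n) ++ fromℕ n ∷ [])
      ≡⟨ List.filter-++ P? (map inject₁ (allFin n)) _ ⟩
    filter P? (map inject₁ (allFin n)) ++ filter P? (fromℕ n ∷ [])
      ≡⟨ cong₂ _++_ (filter-map P? inject₁ (allFin n)) (filter-∷ P? (fromℕ n) []) ⟩
    map inject₁ (filter (P? ∘ inject₁) (allFin n)) ++ cons-if (does (P? (fromℕ n))) (fromℕ n) []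
      ≡⟨ cong₂ _++_ (cong (map inject₁) (List.filter-≐ (P? ∘ inject₁) (λ i → lookup v i ≟ j) same-lookup (allFin n)))
                    (cong (λ c → cons-if (does (c ≟ j)) (fromℕ n) []) (lookup-∷ʳ-fromℕ v a)) ⟩
    map inject₁ (block v j) ++ cons-if (does (a ≟ j)) (fromℕ n) [] ∎
    where
    open ≡-Reasoning
    P? = λ i → lookup (v ∷ʳ a) i ≟ j
    same-lookup = (λ {i} e → trans (sym (lookup-∷ʳ-inject₁ v a i)) e) , (λ {i} e → trans (lookup-∷ʳ-inject₁ v a i) e)

  block-map-inject₁ : ∀ {k n} (v : Vec (Fin k) n) j → block (Vec.map inject₁ v) (inject₁ j) ≡ block v j
  block-map-inject₁ v j = List.filter-≐ _ _
    ( (λ {i} e → inject₁-injective (trans (sym (VecP.lookup-map i inject₁ v)) e))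
    , (λ {i} e → trans (VecP.lookup-map i inject₁ v) (cong inject₁ e)))
    (allFin _)
    where import Data.Vec.Properties as VecP

  block-map-inject₁-fromℕ : ∀ {k n} (v : Vec (Fin k) n) → block (Vec.map inject₁ v) (fromℕ k) ≡ []
  block-map-inject₁-fromℕ v = List.filter-none _
    (All.universal (λ i e → fromℕ≢inject₁ (sym (trans (sym (VecP.lookup-map i inject₁ v)) e))) (allFin _))
    where import Data.Vec.Properties as VecP

  block-∷ : ∀ {k n} (x : Fin k) (v : Vec (Fin k) n) j → block (x Vec.∷ v) j ≡ cons-if (does (x ≟ j)) zero (map suc (block v j))
  block-∷ {n = n} x v j = trans (filter-∷ P? zero (tabulate suc)) (cong (cons-if (does (x ≟ j)) zero)
    (trans (cong (filter P?) (sym (List.map-tabulate id suc))) (filter-map P? suc (allFin n))))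
    where
    P? = λ i → lookup (x Vec.∷ v) i ≟ j

  _≢?_ : ∀ {n} (x i : Fin n) → Dec (x ≢ i)
  x ≢? i = ¬? (x ≟ i)

  remove : ∀ {n} → Fin n → List (Fin n) → List (Fin n)
  remove i = filter (_≢? i)

  Ignores : ∀ {n} → (List (Fin n) → A) → Fin n → Set
  Ignores f i = ∀ L → f L ≡ f (remove i L)

  remove-map-inject₁ : ∀ {n} (i : Fin n) L → remove (inject₁ i) (map inject₁ L) ≡ map inject₁ (remove i L)
  remove-map-inject₁ i L = trans (filter-map (_≢? inject₁ i) inject₁ L)
    (cong (map inject₁) (List.filter-≐ _ (_≢? i) ((λ ne e → ne (cong inject₁ e)) , (λ ne e → ne (inject₁-injective e))) L))

  remove-inject₁-∷ʳ : ∀ {n} (i : Fin n) X → remove (inject₁ i) (X ++ fromℕ n ∷ []) ≡ remove (inject₁ i) X ++ fromℕ n ∷ []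
  remove-inject₁-∷ʳ i X = trans (List.filter-++ (_≢? inject₁ i) X _)
    (cong (remove (inject₁ i) X ++_) (List.filter-accept (_≢? inject₁ i) fromℕ≢inject₁))

  remove-fromℕ-∷ʳ : ∀ {n} (L : List (Fin n)) → remove (fromℕ n) (map inject₁ L ++ fromℕ n ∷ []) ≡ map inject₁ L
  remove-fromℕ-∷ʳ L = begin
    remove (fromℕ _) (map inject₁ L ++ fromℕ _ ∷ [])
      ≡⟨ List.filter-++ (_≢? fromℕ _) (map inject₁ L) _ ⟩
    remove (fromℕ _) (map inject₁ L) ++ remove (fromℕ _) (fromℕ _ ∷ [])
      ≡⟨ cong₂ _++_ (trans (filter-map (_≢? fromℕ _) inject₁ L)
                           (cong (map inject₁) (List.filter-all _ (All.universal (λ x → fromℕ≢inject₁ ∘ sym) L))))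
                    (List.filter-reject (_≢? fromℕ _) (λ ne → ne refl)) ⟩
    map inject₁ L ++ []
      ≡⟨ List.++-identityʳ _ ⟩
    map inject₁ L ∎
    where open ≡-Reasoning

module PartitionSums (R : ℤAlgebra) where

  open ℤAlgebraProperties R public
  open import Data.Vec as Vec using (Vec; _∷ʳ_)

  Partition : ℕ → Set
  Partition n = Σ ℕ (λ k → Vec (Fin k) n)

  children : ∀ {n} → Partition n → List (Partition (suc n))
  children (k , v) = (suc k , Vec.map inject₁ v ∷ʳ fromℕ k) ∷ map (λ j → k , v ∷ʳ j) (allFin k)

  term : ∀ {n} → (List (Fin n) → Carrier) → Partition n → Carrier
  term f (k , v) = ι (piCoeff k) * product (λ j → f (block v j))

  partitionSum : ∀ n → (List (Fin n) → Carrier) → Carrier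
  partitionSum n f = sumOver (partitions n) (term f)

  δ : ℕ → Carrier
  δ zero    = 1#
  δ (suc _) = 0#

piCoeff-suc : ∀ k → piCoeff (suc (suc k)) ≡ piCoeff (suc k) ℤ.* ℤ.- (ℤ.+ suc k)
piCoeff-suc k = begin
  ℤ.-1ℤ ℤ.* (ℤ.-1ℤ ℤ.^ k) ℤ.* ℤ.+ (suc k ℕ.* k !)          ≡⟨ cong (ℤ.-1ℤ ℤ.* (ℤ.-1ℤ ℤ.^ k) ℤ.*_) (ℤ.pos-* (suc k) (k !)) ⟩
  ℤ.-1ℤ ℤ.* (ℤ.-1ℤ ℤ.^ k) ℤ.* (ℤ.+ suc k ℤ.* ℤ.+ (k !))    ≡⟨ reassociate (ℤ.-1ℤ ℤ.^ k) (ℤ.+ suc k) (ℤ.+ (k !)) ⟩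
  (ℤ.-1ℤ ℤ.^ k) ℤ.* ℤ.+ (k !) ℤ.* ℤ.- ℤ.+ suc k            ∎
  where
  open ≡-Reasoning
  open import Data.Integer.Tactic.RingSolver using (solve-∀)
  reassociate : ∀ x s y → ℤ.-1ℤ ℤ.* x ℤ.* (s ℤ.* y) ≡ x ℤ.* y ℤ.* ℤ.- s
  reassociate = solve-∀

module PartitionSumDerivative (R : ℤAlgebra) where

  open PartitionSums R
  open DualNumbers R
  open Blocks
  module Dual = PartitionSums dual
  open import Data.Vec as Vec using (Vec; _∷ʳ_)
  open import Relation.Nullary.Decidable using (dec-true)

  -- Opening a new block for the last vertex multiplies the weight by -k, while
  -- adding it to one of the k blocks differentiates ∏ f(B); both are recorded by
  -- the ε-part of ∏ (1 - cε) (f(B) + f(B ∪ {last}) ε), with c = f({last}).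
  tangent : ∀ {n} → (List (Fin (suc n)) → Carrier) → List (Fin n) → Carrier × Carrier
  tangent {n} f L = (1# , - f (fromℕ n ∷ [])) D.* (f (map inject₁ L) , f (map inject₁ L ++ fromℕ n ∷ []))

  module _ {n} (f : List (Fin (suc n)) → Carrier) {k} (v : Vec (Fin k) n) where

    private
      a b : Fin k → Carrier
      a j = f (map inject₁ (block v j))
      b j = f (map inject₁ (block v j) ++ fromℕ n ∷ [])

    product-new-block : product (λ j → f (block (Vec.map inject₁ v ∷ʳ fromℕ k) j)) ≡ product a * f (fromℕ n ∷ [])
    product-new-block = trans (product-init-last (λ j → f (block (Vec.map inject₁ v ∷ʳ fromℕ k) j)))
      (cong₂ _*_ (product-cong-≗ old-block) new-block)
      where
      old-block : ∀ j → f (block (Vec.map inject₁ v ∷ʳ fromℕ k) (inject₁ j)) ≡ a j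
      old-block j = cong f (begin
        block (Vec.map inject₁ v ∷ʳ fromℕ k) (inject₁ j)
          ≡⟨ block-∷ʳ (Vec.map inject₁ v) (fromℕ k) (inject₁ j) ⟩
        map inject₁ (block (Vec.map inject₁ v) (inject₁ j)) ++ cons-if (does (fromℕ k ≟ inject₁ j)) (fromℕ n) []
          ≡⟨ cong₂ (λ B t → map inject₁ B ++ cons-if t (fromℕ n) []) (block-map-inject₁ v j) (fromℕ≟inject₁ j) ⟩
        map inject₁ (block v j) ++ []
          ≡⟨ List.++-identityʳ _ ⟩
        map inject₁ (block v j) ∎)
        where open ≡-Reasoning
      new-block : f (block (Vec.map inject₁ v ∷ʳ fromℕ k) (fromℕ k)) ≡ f (fromℕ n ∷ [])
      new-block = cong f (trans (block-∷ʳ (Vec.map inject₁ v) (fromℕ k) (fromℕ k))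
        (cong₂ (λ B t → map inject₁ B ++ cons-if t (fromℕ n) []) (block-map-inject₁-fromℕ v) (dec-true (fromℕ k ≟ fromℕ k) refl)))

    product-joined-block : ∀ i → product (λ j → f (block (v ∷ʳ i) j)) ≡ product (λ j → if does (i ≟ j) then b j else a j)
    product-joined-block i = product-cong-≗ λ j → trans (cong f (block-∷ʳ v i j)) (f-cons-if (does (i ≟ j)) (map inject₁ (block v j)))
      where
      f-cons-if : ∀ t X → f (X ++ cons-if t (fromℕ n) []) ≡ (if t then f (X ++ fromℕ n ∷ []) else f X)
      f-cons-if true  X = refl
      f-cons-if false X = cong f (List.++-identityʳ X)

  children-term : ∀ {n} (f : List (Fin (suc n)) → Carrier) k (v : Vec (Fin (suc k)) n) →
    sumOver (children (suc k , v)) (term f) ≡ ε-part (Dual.term (tangent f) (suc k , v))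
  children-term {n} f k v = begin
    term f (suc K , Vec.map inject₁ v ∷ʳ fromℕ K) + sumOver (map (λ i → K , v ∷ʳ i) (allFin K)) (term f)
      ≡⟨ cong₂ _+_ (cong (ι (piCoeff (suc K)) *_) (product-new-block f v))
                   (trans (sumOver-map _ (allFin K) (term f)) (trans (sumOver-allFin K _)
                     (sum-cong-≗ (λ i → cong (ι (piCoeff K) *_) (product-joined-block f v i))))) ⟩
    ι (piCoeff (suc K)) * (product a * c) + sum (λ i → ι (piCoeff K) * P i)
      ≡⟨ cong₂ _+_ (cong (_* (product a * c)) ι-piCoeff-suc) (sym (*-distribˡ-sum (ι (piCoeff K)) P)) ⟩
    ι (piCoeff K) * - ι (ℤ.+ K) * (product a * c) + ι (piCoeff K) * sum P
      ≡⟨ solve 5 (λ p m x c s → (p :* m :* (x :* c) :+ p :* s) := (p :* (s :+ m :* c :* x)))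
           refl (ι (piCoeff K)) (- ι (ℤ.+ K)) (product a) c (sum P) ⟩
    ι (piCoeff K) * (sum P + - ι (ℤ.+ K) * c * product a)
      ≡⟨ cong (λ z → ι (piCoeff K) * (sum P + z * product a)) (sym (-‿distribˡ-* _ _)) ⟩
    ι (piCoeff K) * (sum P + - (ι (ℤ.+ K) * c) * product a)
      ≡⟨ cong (ι (piCoeff K) *_) (sym (ε-part-product-1-ε K c a b)) ⟩
    ι (piCoeff K) * ε-part (D.product (λ j → tangent f (block v j)))
      ≡⟨ sym (ε-part-ι-* (piCoeff K) _) ⟩
    ε-part (Dual.term (tangent f) (K , v)) ∎
    where
    open ≡-Reasoning
    K = suc k
    c = f (fromℕ n ∷ [])
    a b : Fin K → Carrier
    a j = f (map inject₁ (block v j))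
    b j = f (map inject₁ (block v j) ++ fromℕ n ∷ [])
    P = λ i → product (λ j → if does (i ≟ j) then b j else a j)
    ι-piCoeff-suc : ι (piCoeff (suc K)) ≡ ι (piCoeff K) * - ι (ℤ.+ K)
    ι-piCoeff-suc = trans (cong ι (piCoeff-suc k)) (trans (ι-* _ _) (cong (ι (piCoeff K) *_) (ι-neg (ℤ.+ K))))

  partitionSum-suc : ∀ m (f : List (Fin (suc (suc m))) → Carrier) →
    partitionSum (suc (suc m)) f ≡ ε-part (Dual.partitionSum (suc m) (tangent f))
  partitionSum-suc m f = begin
    sumOver (concatMap children (partitions (suc m))) (term f)
      ≡⟨ sumOver-concatMap children (partitions (suc m)) (term f) ⟩
    sumOver (partitions (suc m)) (λ P → sumOver (children P) (term f))
      ≡⟨ sumOver-cong (partitions (suc m)) children-term′ ⟩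
    sumOver (partitions (suc m)) (ε-part ∘ Dual.term (tangent f))
      ≡⟨ sym (ε-part-sumOver (partitions (suc m)) (Dual.term (tangent f))) ⟩
    ε-part (Dual.partitionSum (suc m) (tangent f)) ∎
    where
    open ≡-Reasoning
    children-term′ : ∀ P → sumOver (children P) (term f) ≡ ε-part (Dual.term (tangent f) P)
    children-term′ (zero  , () Vec.∷ _)
    children-term′ (suc k , v) = children-term f k v

  ε-part-partitionSum-zero : ∀ n (g : List (Fin n) → Carrier × Carrier) →
    (∀ L → ε-part (g L) ≡ 0#) → ε-part (Dual.partitionSum n g) ≡ 0#
  ε-part-partitionSum-zero n g ε-g≡0 = trans (ε-part-sumOver (partitions n) (Dual.term g))
    (sumOver-zero (partitions n) λ { (k , v) → trans (ε-part-ι-* (piCoeff k) _)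
      (trans (cong (ι (piCoeff k) *_) (ε-part-product-zero k _ (λ j → ε-g≡0 (block v j)))) (zeroʳ _)) })

  ε-part-δ : ∀ n → ε-part (Dual.δ n) ≡ 0#
  ε-part-δ zero    = refl
  ε-part-δ (suc n) = refl

  module _ {n} {f : List (Fin (suc n)) → Carrier} (f[]≡1 : f [] ≡ 1#) where

    tangent-[] : tangent f [] ≡ D.1#
    tangent-[] = cong₂ _,_ (trans (cong (1# *_) f[]≡1) (*-identityʳ 1#))
      (trans (cong₂ _+_ (*-identityˡ _) (trans (cong (- f (fromℕ n ∷ []) *_) f[]≡1) (*-identityʳ _))) (-‿inverseʳ _))

    ε-part-tangent-ignoring-last : Ignores f (fromℕ n) → ∀ L → ε-part (tangent f L) ≡ 0#
    ε-part-tangent-ignoring-last ignores L = begin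
      1# * f (map inject₁ L ++ fromℕ n ∷ []) + - f (fromℕ n ∷ []) * f (map inject₁ L)
        ≡⟨ cong₂ (λ x c → 1# * x + - c * f (map inject₁ L))
             (trans (ignores _) (cong f (remove-fromℕ-∷ʳ L)))
             (trans (ignores _) (trans (cong f (remove-fromℕ-∷ʳ [])) f[]≡1)) ⟩
      1# * f (map inject₁ L) + - 1# * f (map inject₁ L)
        ≡⟨ cong (1# * f (map inject₁ L) +_) (sym (-‿distribˡ-* 1# _)) ⟩
      1# * f (map inject₁ L) + - (1# * f (map inject₁ L))
        ≡⟨ -‿inverseʳ _ ⟩
      0# ∎
      where open ≡-Reasoning

  tangent-ignores : ∀ {n} {f : List (Fin (suc n)) → Carrier} i → Ignores f (inject₁ i) → Ignores (tangent f) i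
  tangent-ignores {n} {f} i ignores L = cong ((1# , - f (fromℕ n ∷ [])) D.*_) (cong₂ _,_
    (trans (ignores _) (cong f (remove-map-inject₁ i L)))
    (trans (ignores _) (cong f (trans (remove-inject₁-∷ʳ i (map inject₁ L)) (cong (_++ fromℕ n ∷ []) (remove-map-inject₁ i L))))))

partitionSum-ignoring : ∀ n (R : ℤAlgebra) {f : List (Fin (suc n)) → ℤAlgebra.Carrier R} (i : Fin (suc n)) →
  f [] ≡ ℤAlgebra.1# R → Blocks.Ignores f i → PartitionSums.partitionSum R (suc n) f ≡ PartitionSums.δ R n
partitionSum-ignoring zero R zero f[]≡1 ignores =
  trans (+-identityʳ _) (trans (cong₂ _*_ ι-1 (trans (*-identityʳ _) (trans (ignores (zero ∷ [])) f[]≡1))) (*-identityˡ _))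
  where open ℤAlgebra R
partitionSum-ignoring (suc m) R {f} i f[]≡1 ignores with view i
... | ‵fromℕ      = trans (partitionSum-suc m f) (ε-part-partitionSum-zero (suc m) (tangent f) (ε-part-tangent-ignoring-last f[]≡1 ignores))
  where open PartitionSumDerivative R
... | ‵inject₁ i′ = trans (partitionSum-suc m f)
  (trans (cong ε-part (partitionSum-ignoring m dual {tangent f} i′ (tangent-[] {f = f} f[]≡1) (tangent-ignores i′ ignores))) (ε-part-δ m))
  where
  open PartitionSumDerivative R
  open DualNumbers R using (dual; ε-part)

module BooleanDeterminant where

  open import Data.Nat using (_+_)
  open import Data.Fin using (splitAt; punchIn; _↑ˡ_; _↑ʳ_; cast)
  open import Data.Fin.Properties using (splitAt-↑ˡ; splitAt-↑ʳ; cast-is-id)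
  open import Data.Bool using (_∧_; _xor_)
  open import Data.Bool.Properties using (xor-assoc; ∧-assoc; ∧-distribʳ-xor; xor-identityʳ)
  open import Data.Sum as Sum using (_⊎_; inj₁; inj₂)

  Matrix : ℕ → Set
  Matrix n = Fin n → Fin n → Bool

  det₂-cong : ∀ n {M M′ : Matrix n} → (∀ i j → M i j ≡ M′ i j) → det₂ n M ≡ det₂ n M′
  det₂-cong zero    e = refl
  det₂-cong (suc n) e = cong (foldr _xor_ false) (List.map-cong
    (λ j → cong₂ _∧_ (e zero j) (det₂-cong n (λ r c → e (suc r) (punchIn j c)))) (allFin (suc n)))

  det₂-cast : ∀ {a b} (p : a ≡ b) {M : Matrix a} {M′ : Matrix b} →
    (∀ i j → M i j ≡ M′ (cast p i) (cast p j)) → det₂ a M ≡ det₂ b M′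
  det₂-cast {a} refl {M′ = M′} e = det₂-cong a (λ i j → trans (e i j) (cong₂ M′ (cast-is-id refl i) (cast-is-id refl j)))

  ⊎-diagonal : ∀ {m₁ m₂} → Matrix m₁ → Matrix m₂ → Fin m₁ ⊎ Fin m₂ → Fin m₁ ⊎ Fin m₂ → Bool
  ⊎-diagonal M₁ M₂ (inj₁ a) (inj₁ b) = M₁ a b
  ⊎-diagonal M₁ M₂ (inj₁ a) (inj₂ b) = false
  ⊎-diagonal M₁ M₂ (inj₂ a) (inj₁ b) = false
  ⊎-diagonal M₁ M₂ (inj₂ a) (inj₂ b) = M₂ a b

  blockDiagonal : ∀ m₁ {m₂} → Matrix m₁ → Matrix m₂ → Matrix (m₁ + m₂)
  blockDiagonal m₁ M₁ M₂ i j = ⊎-diagonal M₁ M₂ (splitAt m₁ i) (splitAt m₁ j)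

  private
    xorSum : List Bool → Bool
    xorSum = foldr _xor_ false

    xorSum-++ : ∀ xs ys → xorSum (xs ++ ys) ≡ xorSum xs xor xorSum ys
    xorSum-++ []       ys = refl
    xorSum-++ (x ∷ xs) ys = trans (cong (x xor_) (xorSum-++ xs ys)) (sym (xor-assoc x _ _))

    xorSum-false : ∀ {A : Set} (xs : List A) → xorSum (map (λ _ → false) xs) ≡ false
    xorSum-false []       = refl
    xorSum-false (x ∷ xs) = xorSum-false xs

    xorSum-∧ : ∀ {A : Set} (f : A → Bool) b xs → xorSum (map (λ j → f j ∧ b) xs) ≡ xorSum (map f xs) ∧ b
    xorSum-∧ f b []       = refl
    xorSum-∧ f b (x ∷ xs) = trans (cong (f x ∧ b xor_) (xorSum-∧ f b xs)) (sym (∧-distribʳ-xor b (f x) _))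

    allFin-+ : ∀ a b → allFin (a + b) ≡ map (_↑ˡ b) (allFin a) ++ map (a ↑ʳ_) (allFin b)
    allFin-+ a b = trans (tabulate-+ a id) (sym (cong₂ _++_ (List.map-tabulate id (_↑ˡ b)) (List.map-tabulate id (a ↑ʳ_))))
      where
      tabulate-+ : ∀ {A : Set} a (f : Fin (a + b) → A) → tabulate f ≡ tabulate (f ∘ (_↑ˡ b)) ++ tabulate (f ∘ (a ↑ʳ_))
      tabulate-+ zero    f = refl
      tabulate-+ (suc a) f = cong (f zero ∷_) (tabulate-+ a (f ∘ suc))

    splitAt-punchIn-↑ˡ : ∀ m₁ {m₂} (j : Fin (suc m₁)) (c : Fin (m₁ + m₂)) →
      splitAt (suc m₁) (punchIn (j ↑ˡ m₂) c) ≡ Sum.map₁ (punchIn j) (splitAt m₁ c)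
    splitAt-punchIn-↑ˡ m₁        zero    c       = refl
    splitAt-punchIn-↑ˡ (suc m₁)  (suc j) zero    = refl
    splitAt-punchIn-↑ˡ (suc m₁)  (suc j) (suc c) with splitAt m₁ c | splitAt-punchIn-↑ˡ m₁ j c
    ... | inj₁ _ | e = cong (Sum.map₁ suc) e
    ... | inj₂ _ | e = cong (Sum.map₁ suc) e

  minor : ∀ {n} → Matrix (suc n) → Fin (suc n) → Matrix n
  minor M j r c = M (suc r) (punchIn j c)

  minor-blockDiagonal : ∀ m₁ {m₂} (M₁ : Matrix (suc m₁)) (M₂ : Matrix m₂) j r c →
    minor (blockDiagonal (suc m₁) M₁ M₂) (j ↑ˡ m₂) r c ≡ blockDiagonal m₁ (minor M₁ j) M₂ r c
  minor-blockDiagonal m₁ M₁ M₂ j r c =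
    trans (cong (⊎-diagonal M₁ M₂ (Sum.map₁ suc (splitAt m₁ r))) (splitAt-punchIn-↑ˡ m₁ j c))
          (shift-cases (splitAt m₁ r) (splitAt m₁ c))
    where
    shift-cases : ∀ s t → ⊎-diagonal M₁ M₂ (Sum.map₁ suc s) (Sum.map₁ (punchIn j) t) ≡ ⊎-diagonal (minor M₁ j) M₂ s t
    shift-cases (inj₁ _) (inj₁ _) = refl
    shift-cases (inj₁ _) (inj₂ _) = refl
    shift-cases (inj₂ _) (inj₁ _) = refl
    shift-cases (inj₂ _) (inj₂ _) = refl

  det₂-blockDiagonal : ∀ m₁ m₂ (M₁ : Matrix m₁) (M₂ : Matrix m₂) →
    det₂ (m₁ + m₂) (blockDiagonal m₁ M₁ M₂) ≡ det₂ m₁ M₁ ∧ det₂ m₂ M₂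
  det₂-blockDiagonal zero     m₂ M₁ M₂ = refl
  det₂-blockDiagonal (suc m₁) m₂ M₁ M₂ = begin
    xorSum (map expand (allFin (suc m₁ + m₂)))
      ≡⟨ cong (xorSum ∘ map expand) (allFin-+ (suc m₁) m₂) ⟩
    xorSum (map expand (map (_↑ˡ m₂) (allFin (suc m₁)) ++ map (suc m₁ ↑ʳ_) (allFin m₂)))
      ≡⟨ cong xorSum (List.map-++ expand (map (_↑ˡ m₂) (allFin (suc m₁))) _) ⟩
    xorSum (map expand (map (_↑ˡ m₂) (allFin (suc m₁))) ++ map expand (map (suc m₁ ↑ʳ_) (allFin m₂)))
      ≡⟨ xorSum-++ (map expand (map (_↑ˡ m₂) (allFin (suc m₁)))) _ ⟩
    xorSum (map expand (map (_↑ˡ m₂) (allFin (suc m₁)))) xor xorSum (map expand (map (suc m₁ ↑ʳ_) (allFin m₂)))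
      ≡⟨ cong₂ _xor_
           (cong xorSum (trans (sym (List.map-∘ {g = expand} {f = _↑ˡ m₂} (allFin (suc m₁))))
                               (List.map-cong expand-left (allFin (suc m₁)))))
           (trans (cong xorSum (trans (sym (List.map-∘ {g = expand} {f = suc m₁ ↑ʳ_} (allFin m₂)))
                                      (List.map-cong expand-right (allFin m₂))))
                  (xorSum-false (allFin m₂))) ⟩
    xorSum (map (λ j → (M₁ zero j ∧ det₂ m₁ (minor M₁ j)) ∧ det₂ m₂ M₂) (allFin (suc m₁))) xor false
      ≡⟨ xor-identityʳ _ ⟩
    xorSum (map (λ j → (M₁ zero j ∧ det₂ m₁ (minor M₁ j)) ∧ det₂ m₂ M₂) (allFin (suc m₁)))
      ≡⟨ xorSum-∧ (λ j → M₁ zero j ∧ det₂ m₁ (minor M₁ j)) (det₂ m₂ M₂) (allFin (suc m₁)) ⟩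
    det₂ (suc m₁) M₁ ∧ det₂ m₂ M₂ ∎
    where
    open ≡-Reasoning
    M = blockDiagonal (suc m₁) M₁ M₂
    expand : Fin (suc m₁ + m₂) → Bool
    expand j = M zero j ∧ det₂ (m₁ + m₂) (minor M j)
    expand-left : ∀ j → expand (j ↑ˡ m₂) ≡ (M₁ zero j ∧ det₂ m₁ (minor M₁ j)) ∧ det₂ m₂ M₂
    expand-left j = begin
      M zero (j ↑ˡ m₂) ∧ det₂ (m₁ + m₂) (minor M (j ↑ˡ m₂))
        ≡⟨ cong₂ _∧_ (cong (⊎-diagonal M₁ M₂ (inj₁ zero)) (splitAt-↑ˡ (suc m₁) j m₂))
             (trans (det₂-cong (m₁ + m₂) (minor-blockDiagonal m₁ M₁ M₂ j)) (det₂-blockDiagonal m₁ m₂ (minor M₁ j) M₂)) ⟩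
      M₁ zero j ∧ (det₂ m₁ (minor M₁ j) ∧ det₂ m₂ M₂)
        ≡⟨ sym (∧-assoc (M₁ zero j) _ _) ⟩
      (M₁ zero j ∧ det₂ m₁ (minor M₁ j)) ∧ det₂ m₂ M₂ ∎
    expand-right : ∀ j → expand (suc m₁ ↑ʳ j) ≡ false
    expand-right j = cong (λ s → ⊎-diagonal M₁ M₂ (inj₁ zero) s ∧ det₂ (m₁ + m₂) (minor M (suc m₁ ↑ʳ j)))
                          (splitAt-↑ʳ (suc m₁) m₂ j)

module InducedSubgraphs where

  open BooleanDeterminant
  open Blocks using (filter-map; allFin-suc-map)
  open import Data.Nat using (_+_)
  open import Data.Fin using (splitAt; cast)
  open import Data.Fin.Properties using (cast-is-id; cast-trans)
  open import Data.Fin.Subset using (Subset; ∣_∣)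
  open import Data.Bool as Bool using (_∧_)
  open import Data.Vec as Vec using (Vec)
  import Data.Vec.Functional as Vector
  open import Data.List using (filter; length)
  open import Data.Sum as Sum using (inj₁; inj₂)

  private variable
    A B : Set

  -- induce H xs indexes its vertices by Fin (length xs); this relates that
  -- indexing to an enumeration e by Fin m.
  Enumerates : List A → (m : ℕ) → (Fin m → A) → Set
  Enumerates xs m e = Σ (length xs ≡ m) (λ p → ∀ i → Vec.lookup (Vec.fromList xs) i ≡ e (cast p i))

  Enumerates-[] : (e : Fin 0 → A) → Enumerates [] 0 e
  Enumerates-[] e = refl , λ ()

  Enumerates-∷ : ∀ {xs : List A} {m e} x → Enumerates xs m e → Enumerates (x ∷ xs) (suc m) (x Vector.∷ e)
  Enumerates-∷ x (p , q) = cong suc p , λ { zero → refl ; (suc i) → q i }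

  Enumerates-map : ∀ (f : A → B) {xs : List A} {m e} → Enumerates xs m e → Enumerates (map f xs) m (f ∘ e)
  Enumerates-map f {xs} {m} {e} (p , q) = trans (List.length-map f xs) p ,
    λ i → trans (lookup-map xs i) (cong f (trans (q _) (cong e (cast-trans (List.length-map f xs) p i))))
    where
    lookup-map : ∀ xs i → Vec.lookup (Vec.fromList (map f xs)) i ≡ f (Vec.lookup (Vec.fromList xs) (cast (List.length-map f xs) i))
    lookup-map (x ∷ xs) zero    = refl
    lookup-map (x ∷ xs) (suc i) = lookup-map xs i

  Enumerates-≗ : ∀ {xs : List A} {m e e′} → (∀ i → e i ≡ e′ i) → Enumerates xs m e → Enumerates xs m e′
  Enumerates-≗ e≗e′ (p , q) = p , λ i → trans (q i) (e≗e′ _)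

  boolToℤ : Bool → ℤ
  boolToℤ b = if b then ℤ.+ 1 else ℤ.+ 0

  boolToℤ-∧ : ∀ x y → boolToℤ (x ∧ y) ≡ boolToℤ x ℤ.* boolToℤ y
  boolToℤ-∧ true  true  = refl
  boolToℤ-∧ true  false = refl
  boolToℤ-∧ false y     = refl

  ν-induce : ∀ H {xs m e} → Enumerates xs m e → ν (induce H xs) ≡ boolToℤ (det₂ m (λ i j → adj H (e i) (e j)))
  ν-induce H (p , q) = cong boolToℤ (det₂-cast p (λ i j → cong₂ (adj H) (q i) (q j)))

  nth : ∀ {m} (U : Subset m) → Fin ∣ U ∣ → Fin m
  nth (true  Vec.∷ U) = zero Vector.∷ (suc ∘ nth U)
  nth (false Vec.∷ U) = suc ∘ nth U

  elems-∷ : ∀ {m} b (U : Subset m) → elems (b Vec.∷ U) ≡ Blocks.cons-if b zero (map suc (elems U))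
  elems-∷ {m} b U = trans (cong (filter ∈U?) (allFin-suc-map m)) (trans (Blocks.filter-∷ ∈U? zero _)
    (cong₂ (λ t → Blocks.cons-if t zero) (≟true b) (filter-map ∈U? suc (allFin m))))
    where
    ∈U? = λ i → Vec.lookup (b Vec.∷ U) i Bool.≟ true
    ≟true : ∀ b → does (b Bool.≟ true) ≡ b
    ≟true true  = refl
    ≟true false = refl

  Enumerates-elems : ∀ {m} (U : Subset m) → Enumerates (elems U) ∣ U ∣ (nth U)
  Enumerates-elems Vec.[]            = Enumerates-[] _
  Enumerates-elems (true  Vec.∷ U) =
    subst (λ xs → Enumerates xs (suc ∣ U ∣) (nth (true Vec.∷ U))) (sym (elems-∷ true U))
      (Enumerates-∷ zero (Enumerates-map suc {elems U} {∣ U ∣} {nth U} (Enumerates-elems U)))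
  Enumerates-elems (false Vec.∷ U) =
    subst (λ xs → Enumerates xs ∣ U ∣ (nth (false Vec.∷ U))) (sym (elems-∷ false U))
      (Enumerates-map suc {elems U} {∣ U ∣} {nth U} (Enumerates-elems U))

  νSub : (H : Graph) → Subset (n H) → ℤ
  νSub H U = ν (induce H (elems U))

  νSub-nth : ∀ H U → νSub H U ≡ boolToℤ (det₂ ∣ U ∣ (λ i j → adj H (nth U i) (nth U j)))
  νSub-nth H U = ν-induce H {elems U} {∣ U ∣} {nth U} (Enumerates-elems U)

  ∣++∣ : ∀ {a b} (U₁ : Subset a) (U₂ : Subset b) → ∣ U₁ Vec.++ U₂ ∣ ≡ ∣ U₁ ∣ + ∣ U₂ ∣
  ∣++∣ Vec.[]            U₂ = refl
  ∣++∣ (true  Vec.∷ U₁) U₂ = cong suc (∣++∣ U₁ U₂)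
  ∣++∣ (false Vec.∷ U₁) U₂ = ∣++∣ U₁ U₂

  splitAt-nth-++ : ∀ {a b} (U₁ : Subset a) (U₂ : Subset b) .(p : ∣ U₁ Vec.++ U₂ ∣ ≡ ∣ U₁ ∣ + ∣ U₂ ∣) i →
    splitAt a (nth (U₁ Vec.++ U₂) i) ≡ Sum.map (nth U₁) (nth U₂) (splitAt ∣ U₁ ∣ (cast p i))
  splitAt-nth-++ Vec.[]            U₂ p i       = cong (inj₂ ∘ nth U₂) (sym (cast-is-id p i))
  splitAt-nth-++ (true  Vec.∷ U₁) U₂ p zero    = refl
  splitAt-nth-++ (true  Vec.∷ U₁) U₂ p (suc i) with splitAt ∣ U₁ ∣ (cast (cong ℕ.pred p) i) | splitAt-nth-++ U₁ U₂ (cong ℕ.pred p) i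
  ... | inj₁ _ | e = cong (Sum.map₁ suc) e
  ... | inj₂ _ | e = cong (Sum.map₁ suc) e
  splitAt-nth-++ (false Vec.∷ U₁) U₂ p i       with splitAt ∣ U₁ ∣ (cast p i) | splitAt-nth-++ U₁ U₂ p i
  ... | inj₁ _ | e = cong (Sum.map₁ suc) e
  ... | inj₂ _ | e = cong (Sum.map₁ suc) e

  adj-⊔ : ∀ G H i j → adj (G ⊔ H) i j ≡ ⊎-diagonal (adj G) (adj H) (splitAt (n G) i) (splitAt (n G) j)
  adj-⊔ G H i j with splitAt (n G) i | splitAt (n G) j
  ... | inj₁ _ | inj₁ _ = refl
  ... | inj₁ _ | inj₂ _ = refl
  ... | inj₂ _ | inj₁ _ = refl
  ... | inj₂ _ | inj₂ _ = refl

  ⊎-diagonal-map : ∀ {a b m₁ m₂} (M₁ : Matrix a) (M₂ : Matrix b) (f : Fin m₁ → Fin a) (g : Fin m₂ → Fin b) s t →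
    ⊎-diagonal M₁ M₂ (Sum.map f g s) (Sum.map f g t) ≡ ⊎-diagonal (λ x y → M₁ (f x) (f y)) (λ x y → M₂ (g x) (g y)) s t
  ⊎-diagonal-map M₁ M₂ f g (inj₁ _) (inj₁ _) = refl
  ⊎-diagonal-map M₁ M₂ f g (inj₁ _) (inj₂ _) = refl
  ⊎-diagonal-map M₁ M₂ f g (inj₂ _) (inj₁ _) = refl
  ⊎-diagonal-map M₁ M₂ f g (inj₂ _) (inj₂ _) = refl

  νSub-⊔ : ∀ H₁ H₂ (U₁ : Subset (n H₁)) (U₂ : Subset (n H₂)) →
    νSub (H₁ ⊔ H₂) (U₁ Vec.++ U₂) ≡ νSub H₁ U₁ ℤ.* νSub H₂ U₂
  νSub-⊔ H₁ H₂ U₁ U₂ = begin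
    νSub (H₁ ⊔ H₂) (U₁ Vec.++ U₂)
      ≡⟨ νSub-nth (H₁ ⊔ H₂) (U₁ Vec.++ U₂) ⟩
    boolToℤ (det₂ ∣ U₁ Vec.++ U₂ ∣ (λ i j → adj (H₁ ⊔ H₂) (nth (U₁ Vec.++ U₂) i) (nth (U₁ Vec.++ U₂) j)))
      ≡⟨ cong boolToℤ (det₂-cast p {M′ = blockDiagonal ∣ U₁ ∣ M₁ M₂} (λ i j → trans (adj-⊔ H₁ H₂ _ _)
           (trans (cong₂ (⊎-diagonal (adj H₁) (adj H₂)) (splitAt-nth-++ U₁ U₂ p i) (splitAt-nth-++ U₁ U₂ p j))
                  (⊎-diagonal-map (adj H₁) (adj H₂) (nth U₁) (nth U₂) (splitAt ∣ U₁ ∣ (cast p i)) (splitAt ∣ U₁ ∣ (cast p j)))))) ⟩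
    boolToℤ (det₂ (∣ U₁ ∣ + ∣ U₂ ∣) (blockDiagonal ∣ U₁ ∣ M₁ M₂))
      ≡⟨ cong boolToℤ (det₂-blockDiagonal ∣ U₁ ∣ ∣ U₂ ∣ M₁ M₂) ⟩
    boolToℤ (det₂ (∣ U₁ ∣) M₁ ∧ det₂ (∣ U₂ ∣) M₂)
      ≡⟨ boolToℤ-∧ (det₂ ∣ U₁ ∣ M₁) (det₂ ∣ U₂ ∣ M₂) ⟩
    boolToℤ (det₂ ∣ U₁ ∣ M₁) ℤ.* boolToℤ (det₂ ∣ U₂ ∣ M₂)
      ≡⟨ sym (cong₂ ℤ._*_ (νSub-nth H₁ U₁) (νSub-nth H₂ U₂)) ⟩
    νSub H₁ U₁ ℤ.* νSub H₂ U₂ ∎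
    where
    open ≡-Reasoning
    p = ∣++∣ U₁ U₂
    M₁ = λ x y → adj H₁ (nth U₁ x) (nth U₁ y)
    M₂ = λ x y → adj H₂ (nth U₂ x) (nth U₂ y)

module CoefficientSequences where

  open ℤAlgebraProperties ℤ-algebra
  open import Data.Nat.Properties using (suc-injective)
  open import Relation.Nullary.Decidable using (⌊_⌋; isYes≗does; does-⇔)
  open import Function.Bundles using (mk⇔)

  Poly : Set
  Poly = ℕ → ℤ

  infix  4 _≈_
  infixl 7 _⋆_
  infixl 6 _⊕_

  _≈_ : Poly → Poly → Set
  p ≈ q = ∀ s → p s ≡ q s

  _⊕_ : Poly → Poly → Poly
  (p ⊕ q) s = p s + q s

  shift : Poly → Poly
  shift p zero    = 0#
  shift p (suc s) = p s

  monomial : ℕ → ℤ → Poly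
  monomial a x s = if ⌊ a ℕ.≟ s ⌋ then x else 0#

  -- (p ⋆ q) s = Σ_{i + j = s} p i * q j
  _⋆_ : Poly → Poly → Poly
  (p ⋆ q) zero    = p 0 * q 0
  (p ⋆ q) (suc s) = p 0 * q (suc s) + (p ∘ suc ⋆ q) s

  ⋆-product : ∀ k → (Fin k → Poly) → Poly
  ⋆-product zero    ps = monomial 0 1#
  ⋆-product (suc k) ps = ps zero ⋆ ⋆-product k (ps ∘ suc)

  monomial-suc : ∀ a x s → monomial (suc a) x (suc s) ≡ monomial a x s
  monomial-suc a x s = cong (λ b → if b then x else 0#) (trans (isYes≗does (suc a ℕ.≟ suc s))
    (trans (does-⇔ (mk⇔ suc-injective (cong suc)) (suc a ℕ.≟ suc s) (a ℕ.≟ s)) (sym (isYes≗does (a ℕ.≟ s)))))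

  *-monomial : ∀ w a x s → w * monomial a x s ≡ monomial a (w * x) s
  *-monomial w a x s with ⌊ a ℕ.≟ s ⌋
  ... | true  = refl
  ... | false = zeroʳ w

  sumOver-monomial : ∀ {A : Set} (xs : List A) a (X : A → ℤ) s → sumOver xs (λ y → monomial a (X y) s) ≡ monomial a (sumOver xs X) s
  sumOver-monomial xs a X s with ⌊ a ℕ.≟ s ⌋
  ... | true  = refl
  ... | false = sumOver-zero xs (λ _ → refl)

  shift-cong : ∀ {q q′} → q ≈ q′ → shift q ≈ shift q′
  shift-cong q≈q′ zero    = refl
  shift-cong q≈q′ (suc s) = q≈q′ s

  ⋆-cong : ∀ {p p′ q q′} → p ≈ p′ → q ≈ q′ → p ⋆ q ≈ p′ ⋆ q′
  ⋆-cong p≈p′ q≈q′ zero    = cong₂ _*_ (p≈p′ 0) (q≈q′ 0)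
  ⋆-cong p≈p′ q≈q′ (suc s) = cong₂ _+_ (cong₂ _*_ (p≈p′ 0) (q≈q′ (suc s))) (⋆-cong (p≈p′ ∘ suc) q≈q′ s)

  ⋆-zeroˡ : ∀ {p} q → p ≈ (λ _ → 0#) → p ⋆ q ≈ (λ _ → 0#)
  ⋆-zeroˡ q p≈0 zero    = cong (_* q 0) (p≈0 0)
  ⋆-zeroˡ q p≈0 (suc s) = cong₂ _+_ (cong (_* q (suc s)) (p≈0 0)) (⋆-zeroˡ q (p≈0 ∘ suc) s)

  ⋆-distribʳ : ∀ p p′ q → (p ⊕ p′) ⋆ q ≈ p ⋆ q ⊕ p′ ⋆ q
  ⋆-distribʳ p p′ q zero    = distribʳ (q 0) (p 0) (p′ 0)
  ⋆-distribʳ p p′ q (suc s) = trans (cong₂ _+_ (distribʳ (q (suc s)) (p 0) (p′ 0)) (⋆-distribʳ (p ∘ suc) (p′ ∘ suc) q s))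
    (+-interchange (p 0 * q (suc s)) (p′ 0 * q (suc s)) _ _)

  ⋆-distribˡ : ∀ p q q′ → p ⋆ (q ⊕ q′) ≈ p ⋆ q ⊕ p ⋆ q′
  ⋆-distribˡ p q q′ zero    = distribˡ (p 0) (q 0) (q′ 0)
  ⋆-distribˡ p q q′ (suc s) = trans (cong₂ _+_ (distribˡ (p 0) (q (suc s)) (q′ (suc s))) (⋆-distribˡ (p ∘ suc) q q′ s))
    (+-interchange (p 0 * q (suc s)) (p 0 * q′ (suc s)) _ _)

  shift-⋆ : ∀ p q → shift p ⋆ q ≈ shift (p ⋆ q)
  shift-⋆ p q zero    = refl
  shift-⋆ p q (suc s) = +-identityˡ _

  ⋆-shift : ∀ p q → p ⋆ shift q ≈ shift (p ⋆ q)
  ⋆-shift p q zero          = zeroʳ (p 0)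
  ⋆-shift p q (suc zero)    = trans (cong (p 0 * q 0 +_) (⋆-shift (p ∘ suc) q zero)) (+-identityʳ _)
  ⋆-shift p q (suc (suc s)) = cong (p 0 * q (suc s) +_) (⋆-shift (p ∘ suc) q (suc s))

  monomial-zero-⋆ : ∀ w q s → (monomial 0 w ⋆ q) s ≡ w * q s
  monomial-zero-⋆ w q zero    = refl
  monomial-zero-⋆ w q (suc s) = trans (cong (w * q (suc s) +_) (⋆-zeroˡ q (λ _ → refl) s)) (+-identityʳ _)

  ⋆-product-cong : ∀ k {ps qs : Fin k → Poly} → (∀ j → ps j ≈ qs j) → ⋆-product k ps ≈ ⋆-product k qs
  ⋆-product-cong zero    e s = refl
  ⋆-product-cong (suc k) e   = ⋆-cong (e zero) (⋆-product-cong k (e ∘ suc))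

  ⋆-product-monomial-zero : ∀ k (c : Fin k → ℤ) → ⋆-product k (λ j → monomial 0 (c j)) ≈ monomial 0 (product c)
  ⋆-product-monomial-zero zero    c s = refl
  ⋆-product-monomial-zero (suc k) c s = begin
    (monomial 0 (c zero) ⋆ ⋆-product k (λ j → monomial 0 (c (suc j)))) s
      ≡⟨ ⋆-cong (λ _ → refl) (⋆-product-monomial-zero k (c ∘ suc)) s ⟩
    (monomial 0 (c zero) ⋆ monomial 0 (product (c ∘ suc))) s
      ≡⟨ monomial-zero-⋆ (c zero) _ s ⟩
    c zero * monomial 0 (product (c ∘ suc)) s
      ≡⟨ *-monomial (c zero) 0 _ s ⟩
    monomial 0 (product c) s ∎
    where open ≡-Reasoning

  ⋆-product-linearAt : ∀ k (x : Fin k) (p qT qF : Fin k → Poly) →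
    (∀ j → p j ≈ (if does (x ≟ j) then shift (qT j) ⊕ qF j else qF j)) →
    (∀ j → does (x ≟ j) ≡ false → qT j ≈ qF j) →
    ⋆-product k p ≈ shift (⋆-product k qT) ⊕ ⋆-product k qF
  ⋆-product-linearAt (suc k) zero p qT qF p≈ qT≈qF s = begin
    (p zero ⋆ ⋆-product k (p ∘ suc)) s
      ≡⟨ ⋆-cong (p≈ zero) (⋆-product-cong k (λ j → p≈ (suc j))) s ⟩
    ((shift (qT zero) ⊕ qF zero) ⋆ ⋆-product k (qF ∘ suc)) s
      ≡⟨ ⋆-distribʳ _ _ _ s ⟩
    (shift (qT zero) ⋆ ⋆-product k (qF ∘ suc)) s + (qF zero ⋆ ⋆-product k (qF ∘ suc)) s
      ≡⟨ cong (_+ _) (trans (shift-⋆ (qT zero) _ s)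
                            (shift-cong (⋆-cong (λ _ → refl) (⋆-product-cong k (λ j → sym ∘ qT≈qF (suc j) refl))) s)) ⟩
    shift (qT zero ⋆ ⋆-product k (qT ∘ suc)) s + (qF zero ⋆ ⋆-product k (qF ∘ suc)) s ∎
    where open ≡-Reasoning
  ⋆-product-linearAt (suc k) (suc x) p qT qF p≈ qT≈qF s = begin
    (p zero ⋆ ⋆-product k (p ∘ suc)) s
      ≡⟨ ⋆-cong (p≈ zero) (⋆-product-linearAt k x (p ∘ suc) (qT ∘ suc) (qF ∘ suc) (p≈ ∘ suc) (qT≈qF ∘ suc)) s ⟩
    (qF zero ⋆ (shift (⋆-product k (qT ∘ suc)) ⊕ ⋆-product k (qF ∘ suc))) s
      ≡⟨ ⋆-distribˡ _ _ _ s ⟩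
    (qF zero ⋆ shift (⋆-product k (qT ∘ suc))) s + (qF zero ⋆ ⋆-product k (qF ∘ suc)) s
      ≡⟨ cong (_+ _) (trans (⋆-shift _ _ s) (shift-cong (⋆-cong (λ t → sym (qT≈qF zero refl t)) (λ _ → refl)) s)) ⟩
    shift (qT zero ⋆ ⋆-product k (qT ∘ suc)) s + (qF zero ⋆ ⋆-product k (qF ∘ suc)) s ∎
    where open ≡-Reasoning

  monomialSum : ∀ {A : Set} → List A → (A → ℕ) → (A → ℤ) → Poly
  monomialSum xs σ w s = sumOver xs (λ x → monomial (σ x) (w x) s)

  monomialSum-suc : ∀ {A : Set} (xs : List A) σ w → monomialSum xs (suc ∘ σ) w ≈ shift (monomialSum xs σ w)
  monomialSum-suc xs σ w zero    = sumOver-zero xs (λ _ → refl)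
  monomialSum-suc xs σ w (suc s) = sumOver-cong xs (λ x → monomial-suc (σ x) (w x) s)

  monomialSum-⋆ : ∀ {A B : Set} (xs : List A) (ys : List B) σ τ w v →
    monomialSum xs σ w ⋆ monomialSum ys τ v ≈ λ s → sumOver xs (λ x → monomialSum ys (λ y → σ x ℕ.+ τ y) (λ y → w x * v y) s)
  monomialSum-⋆ []       ys σ τ w v s = ⋆-zeroˡ _ (λ _ → refl) s
  monomialSum-⋆ (x ∷ xs) ys σ τ w v s =
    trans (⋆-distribʳ (monomial (σ x) (w x)) (monomialSum xs σ w) _ s)
          (cong₂ _+_ (monomial-⋆ (σ x) (w x) s) (monomialSum-⋆ xs ys σ τ w v s))
    where
    monomial-⋆ : ∀ c w s → (monomial c w ⋆ monomialSum ys τ v) s ≡ monomialSum ys (λ y → c ℕ.+ τ y) (λ y → w * v y) s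
    monomial-⋆ zero    w s       = trans (monomial-zero-⋆ w _ s)
      (trans (*-distribˡ-sumOver w ys _) (sumOver-cong ys (λ y → *-monomial w (τ y) (v y) s)))
    monomial-⋆ (suc c) w zero    = sym (sumOver-zero ys (λ _ → refl))
    monomial-⋆ (suc c) w (suc s) = begin
      (monomial (suc c) w ⋆ monomialSum ys τ v) (suc s)
        ≡⟨ trans (cong (_+ (monomial (suc c) w ∘ suc ⋆ monomialSum ys τ v) s) (zeroˡ (monomialSum ys τ v (suc s)))) (+-identityˡ _) ⟩
      (monomial (suc c) w ∘ suc ⋆ monomialSum ys τ v) s
        ≡⟨ ⋆-cong (monomial-suc c w) (λ _ → refl) s ⟩
      (monomial c w ⋆ monomialSum ys τ v) s
        ≡⟨ monomial-⋆ c w s ⟩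
      monomialSum ys (λ y → c ℕ.+ τ y) (λ y → w * v y) s
        ≡⟨ sym (monomialSum-suc ys (λ y → c ℕ.+ τ y) (λ y → w * v y) (suc s)) ⟩
      monomialSum ys (λ y → suc c ℕ.+ τ y) (λ y → w * v y) (suc s) ∎
      where open ≡-Reasoning

module SubsetExpansions where

  open ℤAlgebraProperties ℤ-algebra
  open CoefficientSequences
  open InducedSubgraphs
  open import Data.Fin.Subset using (Subset; ∣_∣)
  open import Data.Vec as Vec using (Vec)
  open import Data.List using (length)
  import Data.Vec.Functional as Vector

  -- Σ_U ν(H(U)) u^|U|, the skew characteristic polynomial with reversed coefficients.
  qPoly : Graph → Poly
  qPoly H = monomialSum (allSubsets (n H)) ∣_∣ (νSub H)

  sumOver-allSubsets-+ : ∀ a b (F : Subset (a ℕ.+ b) → ℤ) →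
    sumOver (allSubsets (a ℕ.+ b)) F ≡ sumOver (allSubsets a) (λ U₁ → sumOver (allSubsets b) (λ U₂ → F (U₁ Vec.++ U₂)))
  sumOver-allSubsets-+ zero    b F = sym (+-identityʳ _)
  sumOver-allSubsets-+ (suc a) b F = begin
    sumOver (allSubsets (suc (a ℕ.+ b))) F
      ≡⟨ sumOver-pairs (true Vec.∷_) (false Vec.∷_) (allSubsets (a ℕ.+ b)) F ⟩
    sumOver (allSubsets (a ℕ.+ b)) (λ U → F (true Vec.∷ U) + F (false Vec.∷ U))
      ≡⟨ sumOver-+ (allSubsets (a ℕ.+ b)) _ _ ⟩
    sumOver (allSubsets (a ℕ.+ b)) (F ∘ (true Vec.∷_)) + sumOver (allSubsets (a ℕ.+ b)) (F ∘ (false Vec.∷_))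
      ≡⟨ cong₂ _+_ (sumOver-allSubsets-+ a b (F ∘ (true Vec.∷_))) (sumOver-allSubsets-+ a b (F ∘ (false Vec.∷_))) ⟩
    sumOver (allSubsets a) (λ U₁ → G (true Vec.∷ U₁)) + sumOver (allSubsets a) (λ U₁ → G (false Vec.∷ U₁))
      ≡⟨ sym (sumOver-+ (allSubsets a) _ _) ⟩
    sumOver (allSubsets a) (λ U₁ → G (true Vec.∷ U₁) + G (false Vec.∷ U₁))
      ≡⟨ sym (sumOver-pairs (true Vec.∷_) (false Vec.∷_) (allSubsets a) G) ⟩
    sumOver (allSubsets (suc a)) G ∎
    where
    open ≡-Reasoning
    G = λ (U₁ : Subset (suc a)) → sumOver (allSubsets b) (λ U₂ → F (U₁ Vec.++ U₂))

  qPoly-⊔ : ∀ H₁ H₂ → qPoly (H₁ ⊔ H₂) ≈ qPoly H₁ ⋆ qPoly H₂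
  qPoly-⊔ H₁ H₂ s = begin
    sumOver (allSubsets (n H₁ ℕ.+ n H₂)) (λ U → monomial ∣ U ∣ (νSub (H₁ ⊔ H₂) U) s)
      ≡⟨ sumOver-allSubsets-+ (n H₁) (n H₂) _ ⟩
    sumOver (allSubsets (n H₁)) (λ U₁ → sumOver (allSubsets (n H₂)) (λ U₂ →
      monomial ∣ U₁ Vec.++ U₂ ∣ (νSub (H₁ ⊔ H₂) (U₁ Vec.++ U₂)) s))
      ≡⟨ sumOver-cong (allSubsets (n H₁)) (λ U₁ → sumOver-cong (allSubsets (n H₂)) (λ U₂ →
           cong₂ (λ a x → monomial a x s) (∣++∣ U₁ U₂) (νSub-⊔ H₁ H₂ U₁ U₂))) ⟩
    sumOver (allSubsets (n H₁)) (λ U₁ → monomialSum (allSubsets (n H₂)) (λ U₂ → ∣ U₁ ∣ ℕ.+ ∣ U₂ ∣) (λ U₂ → νSub H₁ U₁ * νSub H₂ U₂) s)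
      ≡⟨ sym (monomialSum-⋆ (allSubsets (n H₁)) (allSubsets (n H₂)) ∣_∣ ∣_∣ (νSub H₁) (νSub H₂) s) ⟩
    (qPoly H₁ ⋆ qPoly H₂) s ∎
    where open ≡-Reasoning

  ⨆ : (G : Graph) → ∀ k → (Fin k → List (Fin (n G))) → Graph
  ⨆ G zero    Bs = emptyGraph
  ⨆ G (suc k) Bs = induce G (Bs zero) ⊔ ⨆ G k (Bs ∘ suc)

  blockProduct-⨆ : ∀ G {k} (v : Vec (Fin k) (n G)) → blockProduct G v ≡ ⨆ G k (block v)
  blockProduct-⨆ G {k} v = go k id
    where
    go : ∀ l (h : Fin l → Fin k) → foldr (λ j H → induce G (block v j) ⊔ H) emptyGraph (tabulate h) ≡ ⨆ G l (block v ∘ h)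
    go zero    h = refl
    go (suc l) h = cong (induce G (block v (h zero)) ⊔_) (go l (h ∘ suc))

  qPoly-⨆ : ∀ G k Bs → qPoly (⨆ G k Bs) ≈ ⋆-product k (λ j → qPoly (induce G (Bs j)))
  qPoly-⨆ G zero    Bs s = +-identityʳ _
  qPoly-⨆ G (suc k) Bs s = trans (qPoly-⊔ (induce G (Bs zero)) (⨆ G k (Bs ∘ suc)) s)
    (⋆-cong (λ _ → refl) (qPoly-⨆ G k (Bs ∘ suc)) s)

  sublists : ∀ {A : Set} → List A → List (List A)
  sublists []       = [] ∷ []
  sublists (x ∷ xs) = concatMap (λ S → (x ∷ S) ∷ S ∷ []) (sublists xs)

  subsetPoly : ∀ {A : Set} → List A → (List A → ℤ) → Poly
  subsetPoly B φ = monomialSum (sublists B) length φ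

  select : ∀ {A : Set} (B : List A) → Subset (length B) → List A
  select []       Vec.[]            = []
  select (x ∷ xs) (true  Vec.∷ U) = x ∷ select xs U
  select (x ∷ xs) (false Vec.∷ U) = select xs U

  length-select : ∀ {A : Set} (B : List A) U → ∣ U ∣ ≡ length (select B U)
  length-select []       Vec.[]            = refl
  length-select (x ∷ xs) (true  Vec.∷ U) = cong suc (length-select xs U)
  length-select (x ∷ xs) (false Vec.∷ U) = length-select xs U

  Enumerates-select : ∀ {A : Set} (B : List A) U → Enumerates (select B U) ∣ U ∣ (Vec.lookup (Vec.fromList B) ∘ nth U)
  Enumerates-select []       Vec.[]            = Enumerates-[] _
  Enumerates-select (x ∷ xs) (true  Vec.∷ U) =
    Enumerates-≗ {e = x Vector.∷ (Vec.lookup (Vec.fromList xs) ∘ nth U)}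
                 {e′ = Vec.lookup (Vec.fromList (x ∷ xs)) ∘ nth (true Vec.∷ U)} (λ { zero → refl ; (suc i) → refl })
      (Enumerates-∷ {xs = select xs U} {m = ∣ U ∣} x (Enumerates-select xs U))
  Enumerates-select (x ∷ xs) (false Vec.∷ U) = Enumerates-select xs U

  sumOver-select : ∀ {A : Set} (B : List A) (F : List A → ℤ) → sumOver (allSubsets (length B)) (F ∘ select B) ≡ sumOver (sublists B) F
  sumOver-select []       F = refl
  sumOver-select (x ∷ xs) F = begin
    sumOver (allSubsets (suc (length xs))) (F ∘ select (x ∷ xs))
      ≡⟨ sumOver-pairs (true Vec.∷_) (false Vec.∷_) (allSubsets (length xs)) (F ∘ select (x ∷ xs)) ⟩
    sumOver (allSubsets (length xs)) (λ U → F (x ∷ select xs U) + F (select xs U))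
      ≡⟨ sumOver-+ (allSubsets (length xs)) _ _ ⟩
    sumOver (allSubsets (length xs)) (λ U → F (x ∷ select xs U)) + sumOver (allSubsets (length xs)) (F ∘ select xs)
      ≡⟨ cong₂ _+_ (sumOver-select xs (F ∘ (x ∷_))) (sumOver-select xs F) ⟩
    sumOver (sublists xs) (λ S → F (x ∷ S)) + sumOver (sublists xs) F
      ≡⟨ sym (sumOver-+ (sublists xs) _ _) ⟩
    sumOver (sublists xs) (λ S → F (x ∷ S) + F S)
      ≡⟨ sym (sumOver-pairs (x ∷_) id (sublists xs) F) ⟩
    sumOver (sublists (x ∷ xs)) F ∎
    where open ≡-Reasoning

  qPoly-induce : ∀ G B → qPoly (induce G B) ≈ subsetPoly B (ν ∘ induce G)
  qPoly-induce G B s = trans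
    (sumOver-cong (allSubsets (length B)) (λ U → cong₂ (λ a x → monomial a x s) (length-select B U)
       (trans (νSub-nth (induce G B) U) (sym (ν-induce G {select B U} {∣ U ∣} {Vec.lookup (Vec.fromList B) ∘ nth U} (Enumerates-select B U))))))
    (sumOver-select B (λ S → monomial (length S) (ν (induce G S)) s))

  subsetPoly-cong : ∀ {A : Set} (B : List A) {φ ψ} → (∀ S → φ S ≡ ψ S) → subsetPoly B φ ≈ subsetPoly B ψ
  subsetPoly-cong B φ≗ψ s = sumOver-cong (sublists B) (λ S → cong (λ x → monomial (length S) x s) (φ≗ψ S))

  subsetPoly-∷ : ∀ {A : Set} x (L : List A) φ → subsetPoly (x ∷ L) φ ≈ shift (subsetPoly L (φ ∘ (x ∷_))) ⊕ subsetPoly L φ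
  subsetPoly-∷ x L φ s = begin
    sumOver (concatMap (λ S → (x ∷ S) ∷ S ∷ []) (sublists L)) F
      ≡⟨ sumOver-pairs (x ∷_) id (sublists L) F ⟩
    sumOver (sublists L) (λ S → F (x ∷ S) + F S)
      ≡⟨ sumOver-+ (sublists L) _ _ ⟩
    monomialSum (sublists L) (suc ∘ length) (φ ∘ (x ∷_)) s + subsetPoly L φ s
      ≡⟨ cong (_+ subsetPoly L φ s) (monomialSum-suc (sublists L) length (φ ∘ (x ∷_)) s) ⟩
    shift (subsetPoly L (φ ∘ (x ∷_))) s + subsetPoly L φ s ∎
    where
    open ≡-Reasoning
    F = λ S → monomial (length S) (φ S) s

  subsetPoly-map : ∀ {A B : Set} (f : A → B) L φ → subsetPoly (map f L) φ ≈ subsetPoly L (φ ∘ map f)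
  subsetPoly-map f L φ s = trans (sumOver-sublists-map L _)
    (sumOver-cong (sublists L) (λ S → cong (λ a → monomial a (φ (map f S)) s) (List.length-map f S)))
    where
    sumOver-sublists-map : ∀ L F → sumOver (sublists (map f L)) F ≡ sumOver (sublists L) (F ∘ map f)
    sumOver-sublists-map []      F = refl
    sumOver-sublists-map (x ∷ L) F = trans (sumOver-pairs (f x ∷_) id (sublists (map f L)) F)
      (trans (sumOver-sublists-map L (λ S → F (f x ∷ S) + F S)) (sym (sumOver-pairs (x ∷_) id (sublists L) (F ∘ map f))))

module BlockwiseExpansion where

  open ℤAlgebraProperties ℤ-algebra
  open CoefficientSequences
  open SubsetExpansions
  open Blocks using (cons-if; block-∷; filter-map)
  open import Data.Fin.Subset using (Subset; ∣_∣)
  open import Data.Vec as Vec using (Vec)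
  open import Data.List using (filter)
  import Data.Bool as Bool
  open import Relation.Nullary using (Dec)

  inside? : ∀ {n} (U : Subset n) i → Dec (Vec.lookup U i ≡ true)
  inside? U i = Vec.lookup U i Bool.≟ true

  restrict : ∀ {n} → Subset n → List (Fin n) → List (Fin n)
  restrict U = filter (inside? U)

  restrict-map-suc : ∀ {n} b (U : Subset n) L → restrict (b Vec.∷ U) (map suc L) ≡ map suc (restrict U L)
  restrict-map-suc b U L = filter-map (inside? (b Vec.∷ U)) suc L

  restrict-true : ∀ {n} (U : Subset n) t L → restrict (true Vec.∷ U) (cons-if t zero (map suc L)) ≡ cons-if t zero (map suc (restrict U L))
  restrict-true U true  L = cong (zero ∷_) (restrict-map-suc true U L)
  restrict-true U false L = restrict-map-suc true U L

  restrict-false : ∀ {n} (U : Subset n) t L → restrict (false Vec.∷ U) (cons-if t zero (map suc L)) ≡ map suc (restrict U L)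
  restrict-false U true  L = restrict-map-suc false U L
  restrict-false U false L = restrict-map-suc false U L

  subsetPoly-cons-if : ∀ {n} t (L : List (Fin n)) (φ : List (Fin (suc n)) → ℤ) → subsetPoly (cons-if t zero (map suc L)) φ ≈
    (if t then shift (subsetPoly L (λ S → φ (cons-if t zero (map suc S)))) ⊕ subsetPoly L (φ ∘ map suc) else subsetPoly L (φ ∘ map suc))
  subsetPoly-cons-if true  L φ s = trans (subsetPoly-∷ zero (map suc L) φ s)
    (cong₂ _+_ (shift-cong (subsetPoly-map suc L _) s) (subsetPoly-map suc L φ s))
  subsetPoly-cons-if false L φ s = subsetPoly-map suc L φ s

  blockwisePoly : ∀ n k → Vec (Fin k) n → (Fin k → List (Fin n) → ℤ) → Poly
  blockwisePoly n k v φ = monomialSum (allSubsets n) ∣_∣ (λ U → product (λ j → φ j (restrict U (block v j))))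

  blockwisePoly-⋆ : ∀ n k (v : Vec (Fin k) n) φ → blockwisePoly n k v φ ≈ ⋆-product k (λ j → subsetPoly (block v j) (φ j))
  blockwisePoly-⋆ zero k Vec.[] φ s = trans (+-identityʳ _)
    (sym (trans (⋆-product-cong k (λ j t → +-identityʳ _) s) (⋆-product-monomial-zero k (λ j → φ j []) s)))
  blockwisePoly-⋆ (suc n) k (x Vec.∷ v) φ s = begin
    sumOver (allSubsets (suc n)) G
      ≡⟨ sumOver-pairs (true Vec.∷_) (false Vec.∷_) (allSubsets n) G ⟩
    sumOver (allSubsets n) (λ U → G (true Vec.∷ U) + G (false Vec.∷ U))
      ≡⟨ sumOver-+ (allSubsets n) _ _ ⟩
    sumOver (allSubsets n) (G ∘ (true Vec.∷_)) + sumOver (allSubsets n) (G ∘ (false Vec.∷_))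
      ≡⟨ cong₂ _+_
           (trans (sumOver-cong (allSubsets n) (λ U → cong (λ w → monomial (suc ∣ U ∣) w s)
                    (product-cong-≗ (λ j → cong (φ j) (restrict-true-block U j)))))
                  (monomialSum-suc (allSubsets n) ∣_∣ (λ U → product (λ j → φT j (restrict U (block v j)))) s))
           (sumOver-cong (allSubsets n) (λ U → cong (λ w → monomial ∣ U ∣ w s)
                    (product-cong-≗ (λ j → cong (φ j) (restrict-false-block U j))))) ⟩
    shift (blockwisePoly n k v φT) s + blockwisePoly n k v φF s
      ≡⟨ cong₂ _+_ (shift-cong (blockwisePoly-⋆ n k v φT) s) (blockwisePoly-⋆ n k v φF s) ⟩
    shift (⋆-product k qT) s + ⋆-product k qF s
      ≡⟨ sym (⋆-product-linearAt k x p qT qF p≈ qT≈qF s) ⟩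
    ⋆-product k p s ∎
    where
    open ≡-Reasoning
    G = λ (U : Subset (suc n)) → monomial ∣ U ∣ (product (λ j → φ j (restrict U (block (x Vec.∷ v) j)))) s
    restrict-true-block : ∀ U j →
      restrict (true Vec.∷ U) (block (x Vec.∷ v) j) ≡ cons-if (does (x ≟ j)) zero (map suc (restrict U (block v j)))
    restrict-true-block U j = trans (cong (restrict (true Vec.∷ U)) (block-∷ x v j)) (restrict-true U (does (x ≟ j)) (block v j))
    restrict-false-block : ∀ U j → restrict (false Vec.∷ U) (block (x Vec.∷ v) j) ≡ map suc (restrict U (block v j))
    restrict-false-block U j = trans (cong (restrict (false Vec.∷ U)) (block-∷ x v j)) (restrict-false U (does (x ≟ j)) (block v j))
    φT φF : Fin k → List (Fin n) → ℤ
    φT j S = φ j (cons-if (does (x ≟ j)) zero (map suc S))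
    φF j S = φ j (map suc S)
    p qT qF : Fin k → Poly
    p  j = subsetPoly (block (x Vec.∷ v) j) (φ j)
    qT j = subsetPoly (block v j) (φT j)
    qF j = subsetPoly (block v j) (φF j)
    p≈ : ∀ j → p j ≈ (if does (x ≟ j) then shift (qT j) ⊕ qF j else qF j)
    p≈ j t = trans (cong (λ L → subsetPoly L (φ j) t) (block-∷ x v j)) (subsetPoly-cons-if (does (x ≟ j)) (block v j) (φ j) t)
    qT≈qF : ∀ j → does (x ≟ j) ≡ false → qT j ≈ qF j
    qT≈qF j e = subsetPoly-cong (block v j) (λ S → cong (λ t → φ j (cons-if t zero (map suc S))) e)

module VertexCount where

  open Blocks using (cons-if; block-∷)
  open SubsetExpansions using (⨆; blockProduct-⨆)
  open import Data.Vec as Vec using (Vec)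
  open import Data.List using (length)

  ∑length : ∀ {A : Set} k → (Fin k → List A) → ℕ
  ∑length zero    Bs = 0
  ∑length (suc k) Bs = length (Bs zero) ℕ.+ ∑length k (Bs ∘ suc)

  ∑length-cong : ∀ {A : Set} k {Bs Cs : Fin k → List A} → (∀ j → Bs j ≡ Cs j) → ∑length k Bs ≡ ∑length k Cs
  ∑length-cong zero    e = refl
  ∑length-cong (suc k) e = cong₂ ℕ._+_ (cong length (e zero)) (∑length-cong k (e ∘ suc))

  ∑length-map : ∀ {A B : Set} (f : A → B) k (Bs : Fin k → List A) → ∑length k (λ j → map f (Bs j)) ≡ ∑length k Bs
  ∑length-map f zero    Bs = refl
  ∑length-map f (suc k) Bs = cong₂ ℕ._+_ (List.length-map f (Bs zero)) (∑length-map f k (Bs ∘ suc))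

  ∑length-cons-if : ∀ {n} k (x : Fin k) (Bs : Fin k → List (Fin n)) →
    ∑length k (λ j → cons-if (does (x ≟ j)) (Fin.zero {n}) (map Fin.suc (Bs j))) ≡ suc (∑length k Bs)
  ∑length-cons-if (suc k) zero    Bs = cong suc (∑length-map Fin.suc (suc k) Bs)
  ∑length-cons-if (suc k) (suc x) Bs =
    trans (cong₂ ℕ._+_ (List.length-map Fin.suc (Bs zero)) (∑length-cons-if k x (Bs ∘ suc))) (ℕ.+-suc _ _)
    where import Data.Nat.Properties as ℕ

  ∑length-block : ∀ {k} n (v : Vec (Fin k) n) → ∑length k (block v) ≡ n
  ∑length-block {k} zero    Vec.[]       = all-empty k
    where
    all-empty : ∀ l → ∑length {Fin 0} l (λ _ → []) ≡ 0
    all-empty zero    = refl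
    all-empty (suc l) = all-empty l
  ∑length-block {k} (suc n) (x Vec.∷ v) =
    trans (∑length-cong k (block-∷ x v)) (trans (∑length-cons-if k x (block v)) (cong suc (∑length-block n v)))

  n-⨆ : ∀ G k Bs → n (⨆ G k Bs) ≡ ∑length k Bs
  n-⨆ G zero    Bs = refl
  n-⨆ G (suc k) Bs = cong (length (Bs zero) ℕ.+_) (n-⨆ G k (Bs ∘ suc))

  n-blockProduct : ∀ G {k} (v : Vec (Fin k) (n G)) → n (blockProduct G v) ≡ n G
  n-blockProduct G {k} v = trans (cong n (blockProduct-⨆ G v)) (trans (n-⨆ G k (block v)) (∑length-block (n G) v))

module SkewCoefficientsOfπ where

  open PartitionSums ℤ-algebra
  open CoefficientSequences
  open SubsetExpansions
  open BlockwiseExpansion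
  open Blocks using (remove; cons-if; filter-∷)
  open import Data.Nat using (_<_; s≤s; z≤n)
  open import Data.Fin.Subset using (Subset; ∣_∣)
  open import Data.Vec as Vec using (Vec)
  open import Relation.Nullary using (¬_)
  open import Relation.Nullary.Negation using (contradiction)

  coeffQ-≤ : ∀ H {N} m → n H ≡ N → m ≤ N → coeffQ H m ≡ q (N ∸ m) H
  coeffQ-≤ H m refl m≤n with m ≤? n H
  ... | yes _   = refl
  ... | no  m≰n = contradiction m≤n m≰n

  coeffQ-≰ : ∀ H {N} m → n H ≡ N → ¬ m ≤ N → coeffQ H m ≡ 0#
  coeffQ-≰ H m refl m≰n with m ≤? n H
  ... | yes m≤n = contradiction m≤n m≰n
  ... | no  _   = refl

  coeffQElem-π : ∀ G m →
    coeffQElem (π G) m ≡ sumOver (partitions (n G)) (λ P → piCoeff (proj₁ P) * coeffQ (blockProduct G (proj₂ P)) m)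
  coeffQElem-π G m = sumOver-map _ (partitions (n G)) _

  q-blockProduct : ∀ G {k} (v : Vec (Fin k) (n G)) s →
    q s (blockProduct G v) ≡ blockwisePoly (n G) k v (λ _ → ν ∘ induce G) s
  q-blockProduct G {k} v s = begin
    q s (blockProduct G v)                                      ≡⟨ cong (q s) (blockProduct-⨆ G v) ⟩
    qPoly (⨆ G k (block v)) s                                   ≡⟨ qPoly-⨆ G k (block v) s ⟩
    ⋆-product k (λ j → qPoly (induce G (block v j))) s          ≡⟨ ⋆-product-cong k (λ j → qPoly-induce G (block v j)) s ⟩
    ⋆-product k (λ j → subsetPoly (block v j) (ν ∘ induce G)) s ≡⟨ blockwisePoly-⋆ (n G) k v (λ _ → ν ∘ induce G) s ⟨
    blockwisePoly (n G) k v (λ _ → ν ∘ induce G) s               ∎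
    where open ≡-Reasoning

  partitionSum-q : ∀ G s →
    sumOver (partitions (n G)) (λ P → piCoeff (proj₁ P) * q s (blockProduct G (proj₂ P)))
      ≡ sumOver (allSubsets (n G)) (λ U → monomial ∣ U ∣ (partitionSum (n G) (ν ∘ induce G ∘ restrict U)) s)
  partitionSum-q G s = begin
    sumOver (partitions (n G)) (λ P → piCoeff (proj₁ P) * q s (blockProduct G (proj₂ P)))
      ≡⟨ sumOver-cong (partitions (n G)) (λ P → trans (cong (piCoeff (proj₁ P) *_) (q-blockProduct G (proj₂ P) s))
           (trans (*-distribˡ-sumOver (piCoeff (proj₁ P)) (allSubsets (n G)) _)
                  (sumOver-cong (allSubsets (n G)) (λ U → *-monomial (piCoeff (proj₁ P)) ∣ U ∣ _ s)))) ⟩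
    sumOver (partitions (n G)) (λ P → sumOver (allSubsets (n G)) (λ U → monomial ∣ U ∣ (term (ν ∘ induce G ∘ restrict U) P) s))
      ≡⟨ sumOver-swap (partitions (n G)) (allSubsets (n G)) _ ⟩
    sumOver (allSubsets (n G)) (λ U → sumOver (partitions (n G)) (λ P → monomial ∣ U ∣ (term (ν ∘ induce G ∘ restrict U) P) s))
      ≡⟨ sumOver-cong (allSubsets (n G)) (λ U → sumOver-monomial (partitions (n G)) ∣ U ∣ _ s) ⟩
    sumOver (allSubsets (n G)) (λ U → monomial ∣ U ∣ (partitionSum (n G) (ν ∘ induce G ∘ restrict U)) s) ∎
    where open ≡-Reasoning

  restrict-remove : ∀ {N} (U : Subset N) i → Vec.lookup U i ≡ false → ∀ L → restrict U (remove i L) ≡ restrict U L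
  restrict-remove U i Uᵢ≡false []      = refl
  restrict-remove U i Uᵢ≡false (x ∷ L) with x ≟ i
  ... | yes refl = trans (restrict-remove U i Uᵢ≡false L)
                     (sym (List.filter-reject (inside? U) (λ Uᵢ≡true → contradiction (trans (sym Uᵢ≡false) Uᵢ≡true) λ ())))
  ... | no  _    = trans (filter-∷ (inside? U) x (remove i L))
                     (trans (cong (cons-if _ x) (restrict-remove U i Uᵢ≡false L)) (sym (filter-∷ (inside? U) x L)))

  outside-vertex : ∀ {N} (U : Subset N) → ∣ U ∣ < N → Σ (Fin N) (λ i → Vec.lookup U i ≡ false)
  outside-vertex (true  Vec.∷ U) (s≤s ∣U∣<N) = let i , Uᵢ≡false = outside-vertex U ∣U∣<N in suc i , Uᵢ≡false
  outside-vertex (false Vec.∷ U) _            = zero , refl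

  partitionSum-restrict-proper : ∀ {N} → 2 ≤ N → (f : List (Fin N) → ℤ) → f [] ≡ 1# →
    (U : Subset N) → ∣ U ∣ < N → partitionSum N (f ∘ restrict U) ≡ 0#
  partitionSum-restrict-proper {suc (suc N)} (s≤s (s≤s z≤n)) f f[]≡1 U ∣U∣<N =
    let i , Uᵢ≡false = outside-vertex U ∣U∣<N in
    partitionSum-ignoring (suc N) ℤ-algebra i f[]≡1 (λ L → cong f (sym (restrict-remove U i Uᵢ≡false L)))

  monomial-partitionSum-restrict : ∀ G → 2 ≤ n G → ∀ {s} → s < n G → ∀ U →
    monomial ∣ U ∣ (partitionSum (n G) (ν ∘ induce G ∘ restrict U)) s ≡ 0#
  monomial-partitionSum-restrict G 2≤n {s} s<n U with ∣ U ∣ ℕ.≟ s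
  ... | no  _     = refl
  ... | yes ∣U∣≡s = partitionSum-restrict-proper 2≤n (ν ∘ induce G) refl U (subst (_< n G) (sym ∣U∣≡s) s<n)

open SkewCoefficientsOfπ
open PartitionSums ℤ-algebra using (sumOver; sumOver-cong; sumOver-zero; partitionSum; _*_; zeroʳ)
open CoefficientSequences using (monomial)
open VertexCount using (n-blockProduct)
open BlockwiseExpansion using (restrict)

mainTheorem2 : (G : Graph) → IsSimple G → 2 ≤ n G → IsConstantQ (π G)
mainTheorem2 G _ 2≤n m 1≤m with m ≤? n G
... | no  m≰n = trans (coeffQElem-π G m) (sumOver-zero (partitions (n G))
  (λ P → trans (cong (piCoeff (proj₁ P) *_) (coeffQ-≰ _ m (n-blockProduct G (proj₂ P)) m≰n)) (zeroʳ (piCoeff (proj₁ P)))))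
... | yes m≤n = begin
  coeffQElem (π G) m
    ≡⟨ coeffQElem-π G m ⟩
  sumOver (partitions (n G)) (λ P → piCoeff (proj₁ P) * coeffQ (blockProduct G (proj₂ P)) m)
    ≡⟨ sumOver-cong (partitions (n G)) (λ P → cong (piCoeff (proj₁ P) *_) (coeffQ-≤ _ m (n-blockProduct G (proj₂ P)) m≤n)) ⟩
  sumOver (partitions (n G)) (λ P → piCoeff (proj₁ P) * q s (blockProduct G (proj₂ P)))
    ≡⟨ partitionSum-q G s ⟩
  sumOver (allSubsets (n G)) (λ U → monomial ∣ U ∣ (partitionSum (n G) (ν ∘ induce G ∘ restrict U)) s)
    ≡⟨ sumOver-zero (allSubsets (n G)) (monomial-partitionSum-restrict G 2≤n (∸-monoʳ-< 1≤m m≤n)) ⟩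
  ℤ.+ 0 ∎
  where
  open ≡-Reasoning
  s = n G ∸ m
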